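{- Let $G$ be a graph with a 2-separation $G_1,G_2$, let $\{i,j\}=V(G_1)\cap V(G_2)$, and let $u\in V(G_1)$ and $v\in V(G_2)$. Then \begin{align*} \mathcal{F}_G(u,v) =\ & \mathcal{F}_{G_1/ij}(u,ij)\,T(G_2) +\mathcal{F}_{G_2/ij}(v,ij)\,T(G_1)\\ & + \mathcal{F}_{G_1}(u,i)\,\mathcal{F}_{G_2}(v,j)+\mathcal{F}_{G_1}(u,j)\,\mathcal{F}_{G_2}(v,i) \\ & - 2\,\mathcal{F}_{G_1}(u,\{i,j\})\,\mathcal{F}_{G_2}(v,\{i,j\}). \end{align*}
   Context: Graphs are finite and undirected; multiple edges are allowed, loops are not. $T(G)$ denotes the number of spanning trees of $G$. For vertices $u,v$ of $G$, $\mathcal{F}_G(u,v)$ denotes the number of spanning forests of $G$ with exactly two components in which $u$ and $v$ lie in different components; $\mathcal{F}_G(u,\{v,w\})$ denotes the number of spanning forests of $G$ with exactly two components such that $v$ and $w$ lie in one component and $u$ in the other. A 2-separation of $G$ is a pair of subgraphs $G_1,G_2$ such that $V(G)=V(G_1)\cup V(G_2)$, $|V(G_1)\cap V(G_2)|=2$, $E(G)=E(G_1)\cup E(G_2)$ and $E(G_1)\cap E(G_2)=\emptyset$. For vertices $i,j$ of a graph $H$, $H/ij$ is the graph obtained by identifying $i$ and $j$ into a single vertex called $ij$: every edge $\{x,i\}$ or $\{x,j\}$ with $x\neq i,j$ is replaced by an edge $\{x,ij\}$ (so common neighbours give multiple edges), edges not meeting $i$ or $j$ remain, and edges between $i$ and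 $j$ disappear. If $u$ (resp. $v$) equals $i$ or $j$, in $H/ij$ it is interpreted as the vertex $ij$. -}

module Defs where

open import Data.Nat using (ℕ; zero; suc)
open import Data.Bool using (Bool; true; false; _∧_; _∨_; not; if_then_else_; T)
open import Data.Fin using (Fin; _≟_)
open import Data.List using (List; []; _∷_; _++_; map; allFin; [_])
open import Data.Bool.ListAction using (any; all)
open import Data.Product using (_×_; _,_; proj₁; proj₂)
open import Data.List.Relation.Unary.All using (All)
open import Relation.Nullary.Decidable using (⌊_⌋)
open import Relation.Binary.PropositionalEquality using (_≢_)

-- A (raw) graph is a vertex set V ⊆ Fin n (characteristic function) and a
-- list E of edges; each list entry is one edge (so repeated entries are
-- parallel edges); an edge (a , b) stands for the unordered edge {a,b}.

record RawGraph (n : ℕ) : Set where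
  constructor mkGraph
  field
    V : Fin n → Bool
    E : List (Fin n × Fin n)
open RawGraph public

record IsGraph {n : ℕ} (G : RawGraph n) : Set where
  field
    loopless : All (λ e → proj₁ e ≢ proj₂ e) (E G)
    closed   : All (λ e → T (V G (proj₁ e)) × T (V G (proj₂ e))) (E G)

_==_ : ∀ {n} → Fin n → Fin n → Bool
x == y = ⌊ x ≟ y ⌋

-- Spanning subgraphs: all sub-multisets of the edge list (each edge
-- occurrence independently kept or dropped), 2^|E| of them.

subsets : ∀ {A : Set} → List A → List (List A)
subsets [] = [ [] ]
subsets (x ∷ xs) = subsets xs ++ map (x ∷_) (subsets xs)

splits : ∀ {A : Set} → List A → List (A × List A)
splits [] = []
splits (x ∷ xs) = (x , xs) ∷ map (λ p → proj₁ p , x ∷ proj₂ p) (splits xs)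

countB : ∀ {A : Set} → (A → Bool) → List A → ℕ
countB p [] = 0
countB p (x ∷ xs) = if p x then suc (countB p xs) else countB p xs

reach : ∀ {n} → ℕ → List (Fin n × Fin n) → Fin n → Fin n → Bool
reach zero    S u x = u == x
reach (suc k) S u x =
  reach k S u x ∨
  any (λ e → (reach k S u (proj₁ e) ∧ (proj₂ e == x))
           ∨ (reach k S u (proj₂ e) ∧ (proj₁ e == x))) S

-- walks of length ≤ n suffice (n = size of the ambient vertex type)
conn : ∀ {n} → List (Fin n × Fin n) → Fin n → Fin n → Bool
conn {n} S u x = reach n S u x

-- S is acyclic (a forest): no edge of S lies on a cycle, i.e. the endpoints
-- of each edge of S are disconnected in S minus that edge.
acyclic : ∀ {n} → List (Fin n × Fin n) → Bool
acyclic S = all (λ p → not (conn (proj₂ p) (proj₁ (proj₁ p)) (proj₂ (proj₁ p)))) (splits S)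

forallV : ∀ {n} → RawGraph n → (Fin n → Bool) → Bool
forallV {n} G p = all (λ x → not (V G x) ∨ p x) (allFin n)

isSpanningTree : ∀ {n} → RawGraph n → List (Fin n × Fin n) → Bool
isSpanningTree G S =
  acyclic S ∧ forallV G (λ x → forallV G (λ y → conn S x y))

τ : ∀ {n} → RawGraph n → ℕ
τ G = countB (isSpanningTree G) (subsets (E G))

isF2 : ∀ {n} → RawGraph n → Fin n → Fin n → List (Fin n × Fin n) → Bool
isF2 G u v S =
  acyclic S ∧ not (conn S u v) ∧ forallV G (λ x → conn S u x ∨ conn S v x)

𝓕 : ∀ {n} → RawGraph n → Fin n → Fin n → ℕ
𝓕 G u v = countB (isF2 G u v) (subsets (E G))

𝓕₂ : ∀ {n} → RawGraph n → Fin n → Fin n → Fin n → ℕ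
𝓕₂ G u v w = countB (λ S → isF2 G u v S ∧ conn S v w) (subsets (E G))

-- Contraction H/ij: j is identified with i (the merged vertex ij is
-- represented by i); edges between i and j disappear; other edges at j are
-- redirected to i (producing parallel edges for common neighbours).

mergeV : ∀ {n} → Fin n → Fin n → Fin n → Fin n
mergeV i j x = if x == j then i else x

isIJ : ∀ {n} → Fin n → Fin n → Fin n × Fin n → Bool
isIJ i j e = ((proj₁ e == i) ∧ (proj₂ e == j)) ∨ ((proj₁ e == j) ∧ (proj₂ e == i))

dropIJ : ∀ {n} → Fin n → Fin n → List (Fin n × Fin n) → List (Fin n × Fin n)
dropIJ i j [] = []
dropIJ i j (e ∷ es) = if isIJ i j e then dropIJ i j es else e ∷ dropIJ i j es

contract : ∀ {n} → RawGraph n → Fin n → Fin n → RawGraph n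
contract H i j = mkGraph
  (λ x → V H x ∧ not (x == j))
  (map (λ e → mergeV i j (proj₁ e) , mergeV i j (proj₂ e)) (dropIJ i j (E H)))

module Submission where

open import Defs
open import Data.Nat as ℕ using (ℕ; zero; suc; _≤_; z≤n; s≤s)
import Data.Nat.Properties as ℕₚ
open import Data.Integer using (ℤ; +_; _+_; _-_; _*_; -_; 0ℤ; 1ℤ)
import Data.Integer.Properties as ℤₚ
open import Algebra.Properties.CommutativeSemigroup ℕₚ.+-commutativeSemigroup using (interchange)
open import Algebra.Properties.CommutativeSemigroup ℤₚ.+-commutativeSemigroup
  using () renaming (interchange to ℤ-interchange)
open import Data.Bool using (Bool; true; false; _∧_; _∨_; not; T)
open import Data.Bool.Properties using (T-∧; T-∨; T-≡; ∧-assoc; ∨-comm; ∧-commutativeMonoid)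
open import Algebra.Solver.CommutativeMonoid ∧-commutativeMonoid using (solve; _⊜_; _⊕_)
open import Data.Bool.ListAction using (any; all)
open import Data.Fin using (Fin; _≟_)
open import Data.List using (List; []; _∷_; _++_; map; allFin; [_]; length)
open import Data.List.Properties using (length-tabulate; map-id; map-++; map-∘)
open import Data.List.Relation.Binary.Permutation.Propositional as ↭ using (_↭_; prep; swap; ↭-refl; ↭-sym; ↭-trans)
open import Data.List.Relation.Binary.Permutation.Propositional.Properties using (++-comm; drop-∷)
open import Data.List.Membership.Propositional using (_∈_; find; lose)
open import Data.List.Membership.Propositional.Properties using (∈-allFin; ∈-++⁺ˡ; ∈-++⁺ʳ; ∈-++⁻; ∈-map⁺; ∈-map⁻)
open import Data.List.Relation.Unary.Any using (here; there)
import Data.List.Relation.Unary.All as All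
open import Data.List.Relation.Unary.Any.Properties using (any⁺; any⁻)
open import Data.List.Relation.Unary.All.Properties using (all⁺; all⁻)
open import Data.List.Relation.Binary.Subset.Propositional using (_⊆_)
open import Data.List.Relation.Binary.Subset.Propositional.Properties using (xs⊆xs++ys; xs⊆ys++xs; xs⊆x∷xs; ⊆-reflexive-↭)
open import Data.Product using (_×_; _,_; proj₁; proj₂; Σ)
open import Data.Sum using (_⊎_; inj₁; inj₂) renaming ([_,_] to either)
open import Data.Empty using (⊥-elim)
open import Function using (_∘_)
open import Function.Bundles using (Equivalence; _⇔_)
open import Relation.Nullary using (¬_)
open import Relation.Nullary.Decidable using (toWitness; fromWitness)
open import Relation.Binary.PropositionalEquality hiding ([_])

-- An edge set of G = G₁ ∪ G₂ is a pair (s₁, s₂) of edge sets of the two sides.  Relative to a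
-- terminal w (u on G₁, v on G₂) and the separator {i, j}, an edge set s of one side has a
-- profile: whether s is a forest each of whose components meets {w, i, j}, and which of the
-- three vertices w, i, j it joins.  The proof has three parts.
--  1. Gluing: connectivity in s₁ ++ s₂ is read off from the two sides (Glue), and s₁ ++ s₂ is a
--     forest iff both sides are and they do not both join i and j (acyclic-union).  Hence
--     "s₁ ++ s₂ is a 2-forest separating u and v" is a Boolean function `glued` of the two
--     profiles (Gluing.glued-profiles).
--  2. Each count on the right-hand side counts the edge sets of one side by a condition on their
--     profile (SideProfile); for G₁/ij this uses that edge sets of the contraction are the edge
--     sets avoiding i–j edges with j renamed to i (Contraction).
--  3. Both sides of the identity become double sums over the pairs (s₁, s₂) (count-subsets-++,
--     DoubleSum) whose summands agree: a profile realises one of the five partitions of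
--     {w, i, j}, and glued-weight checks the 25 pairs of partitions.

T∧ : ∀ {a b} → T a → T b → T (a ∧ b)
T∧ {a} {b} p q = Equivalence.from (T-∧ {a} {b}) (p , q)

T∧₁ : ∀ {a b} → T (a ∧ b) → T a
T∧₁ {a} {b} t = proj₁ (Equivalence.to (T-∧ {a} {b}) t)

T∧₂ : ∀ {a b} → T (a ∧ b) → T b
T∧₂ {a} {b} t = proj₂ (Equivalence.to (T-∧ {a} {b}) t)

T∨ : ∀ {a b} → T (a ∨ b) → T a ⊎ T b
T∨ {a} {b} = Equivalence.to (T-∨ {a} {b})

T∨₁ : ∀ {a b} → T a → T (a ∨ b)
T∨₁ {a} {b} p = Equivalence.from (T-∨ {a} {b}) (inj₁ p)

T∨₂ : ∀ {a b} → T b → T (a ∨ b)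
T∨₂ {a} {b} p = Equivalence.from (T-∨ {a} {b}) (inj₂ p)

Tnot : ∀ {a} → ¬ T a → T (not a)
Tnot {true}  f = f _
Tnot {false} _ = _

Tnot⁻ : ∀ {a} → T (not a) → ¬ T a
Tnot⁻ {true} ()

T-dec : ∀ a → T a ⊎ ¬ T a
T-dec true  = inj₁ _
T-dec false = inj₂ (λ ())

T-ext : ∀ {a b} → (T a → T b) → (T b → T a) → a ≡ b
T-ext {true}  {true}  _ _ = refl
T-ext {true}  {false} f _ = ⊥-elim (f _)
T-ext {false} {true}  _ g = ⊥-elim (g _)
T-ext {false} {false} _ _ = refl

==→≡ : ∀ {n} {x y : Fin n} → T (x == y) → x ≡ y
==→≡ {x = x} {y} = toWitness {a? = x ≟ y}

≡→== : ∀ {n} {x y : Fin n} → x ≡ y → T (x == y)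
≡→== {x = x} {y} = fromWitness {a? = x ≟ y}

any→ : ∀ {A : Set} (p : A → Bool) xs → T (any p xs) → Σ A λ e → e ∈ xs × T (p e)
any→ p xs t = find (any⁻ p xs t)

→any : ∀ {A : Set} (p : A → Bool) {xs e} → e ∈ xs → T (p e) → T (any p xs)
→any p m t = any⁺ p (lose m t)

forallV→ : ∀ {n} (G : RawGraph n) p → T (forallV G p) → ∀ x → T (V G x) → T (p x)
forallV→ {n} G p t x vx with T∨ {not (V G x)} (All.lookup (all⁺ _ (allFin n) t) (∈-allFin x))
... | inj₁ h = ⊥-elim (Tnot⁻ h vx)
... | inj₂ h = h

→forallV : ∀ {n} (G : RawGraph n) p → (∀ x → T (V G x) → T (p x)) → T (forallV G p)
→forallV {n} G p f = all⁻ _ (All.tabulate {xs = allFin n} (λ {x} _ → at x))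
  where
  at : ∀ x → T (not (V G x) ∨ p x)
  at x with T-dec (V G x)
  ... | inj₁ v  = T∨₂ {not (V G x)} (f x v)
  ... | inj₂ nv = T∨₁ (Tnot nv)

forallV-cong : ∀ {n} (G : RawGraph n) p q → (∀ x → p x ≡ q x) → forallV G p ≡ forallV G q
forallV-cong G p q h =
  T-ext (λ t → →forallV G q (λ x vx → subst T (h x) (forallV→ G p t x vx)))
        (λ t → →forallV G p (λ x vx → subst T (sym (h x)) (forallV→ G q t x vx)))

countB-mono : ∀ {A : Set} (f g : A → Bool) xs → (∀ x → T (f x) → T (g x)) →
  countB f xs ≤ countB g xs
countB-mono f g [] h = z≤n
countB-mono f g (x ∷ xs) h with f x in ef | g x in eg
... | true  | true  = s≤s (countB-mono f g xs h)
... | true  | false = ⊥-elim (subst T eg (h x (subst T (sym ef) _)))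
... | false | true  = ℕₚ.m≤n⇒m≤1+n (countB-mono f g xs h)
... | false | false = countB-mono f g xs h

countB-mono-eq : ∀ {A : Set} (f g : A → Bool) xs → (∀ x → T (f x) → T (g x)) →
  countB f xs ≡ countB g xs → ∀ {x} → x ∈ xs → g x ≡ f x
countB-mono-eq f g (y ∷ xs) h e m with f y in ef | g y in eg
countB-mono-eq f g (y ∷ xs) h e (here refl) | true | true = trans eg (sym ef)
countB-mono-eq f g (y ∷ xs) h e (there m)   | true | true =
  countB-mono-eq f g xs h (ℕₚ.suc-injective e) m
... | true  | false = ⊥-elim (subst T eg (h y (subst T (sym ef) _)))
... | false | true  = ⊥-elim (ℕₚ.<-irrefl e (s≤s (countB-mono f g xs h)))
countB-mono-eq f g (y ∷ xs) h e (here refl) | false | false = trans eg (sym ef)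
countB-mono-eq f g (y ∷ xs) h e (there m)   | false | false = countB-mono-eq f g xs h e m

countB≤length : ∀ {A : Set} (f : A → Bool) xs → countB f xs ≤ length xs
countB≤length f [] = z≤n
countB≤length f (x ∷ xs) with f x
... | true  = s≤s (countB≤length f xs)
... | false = ℕₚ.m≤n⇒m≤1+n (countB≤length f xs)

countB-pos : ∀ {A : Set} (f : A → Bool) {xs x} → x ∈ xs → T (f x) → 1 ≤ countB f xs
countB-pos f {y ∷ xs} m t with f y in ef
... | true = s≤s z≤n
countB-pos f {y ∷ xs} (here refl) t | false = ⊥-elim (subst T ef t)
countB-pos f {y ∷ xs} (there m)   t | false = countB-pos f m t

countB-cong : ∀ {A : Set} (p q : A → Bool) xs → (∀ {x} → x ∈ xs → p x ≡ q x) →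
  countB p xs ≡ countB q xs
countB-cong p q [] h = refl
countB-cong p q (x ∷ xs) h with p x | q x | h (here refl)
... | true  | .true  | refl = cong suc (countB-cong p q xs (h ∘ there))
... | false | .false | refl = countB-cong p q xs (h ∘ there)

countB-++ : ∀ {A : Set} (p : A → Bool) xs ys → countB p (xs ++ ys) ≡ countB p xs ℕ.+ countB p ys
countB-++ p [] ys = refl
countB-++ p (x ∷ xs) ys with p x
... | true  = cong suc (countB-++ p xs ys)
... | false = countB-++ p xs ys

countB-map : ∀ {A B : Set} (p : B → Bool) (f : A → B) xs → countB p (map f xs) ≡ countB (p ∘ f) xs
countB-map p f [] = refl
countB-map p f (x ∷ xs) with p (f x)
... | true  = cong suc (countB-map p f xs)
... | false = countB-map p f xs

countB-false : ∀ {A : Set} (p : A → Bool) xs → (∀ x → p x ≡ false) → countB p xs ≡ 0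
countB-false p [] h = refl
countB-false p (x ∷ xs) h rewrite h x = countB-false p xs h

Edges : ℕ → Set
Edges n = List (Fin n × Fin n)

Conn : ∀ {n} → Edges n → Fin n → Fin n → Set
Conn S x y = T (conn S x y)

any-cong : ∀ {A : Set} (p q : A → Bool) xs → (∀ e → p e ≡ q e) → any p xs ≡ any q xs
any-cong p q [] h = refl
any-cong p q (x ∷ xs) h = cong₂ _∨_ (h x) (any-cong p q xs h)

-- conn uses walks of length ≤ n.  The set of vertices reached from u grows strictly until it
-- stabilises, so it is stable by step n; this makes Conn closed under traversing edges.
module Stabilisation {n : ℕ} (S : Edges n) (u : Fin n) where

  Stable : ℕ → Set
  Stable k = ∀ x → reach (suc k) S u x ≡ reach k S u x

  -- reach (suc k) is computed from reach k alone, so stability propagates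
  stable-suc : ∀ k → Stable k → Stable (suc k)
  stable-suc k h x = cong₂ _∨_ (h x) (any-cong _ _ S (λ e →
    cong₂ _∨_ (cong (_∧ (proj₂ e == x)) (h (proj₁ e))) (cong (_∧ (proj₁ e == x)) (h (proj₂ e)))))

  reached : ℕ → ℕ
  reached k = countB (reach k S u) (allFin n)

  reach-refl : ∀ k → T (reach k S u u)
  reach-refl zero    = ≡→== refl
  reach-refl (suc k) = T∨₁ (reach-refl k)

  growth : ∀ k → suc k ≤ reached k ⊎ Stable k
  growth zero = inj₁ (countB-pos _ (∈-allFin u) (reach-refl 0))
  growth (suc k) with ℕₚ.m≤n⇒m<n∨m≡n (countB-mono (reach k S u) (reach (suc k) S u) (allFin n) (λ _ → T∨₁))
  ... | inj₂ same = inj₂ (stable-suc k (λ x →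
          countB-mono-eq (reach k S u) (reach (suc k) S u) (allFin n) (λ _ → T∨₁) same (∈-allFin x)))
  ... | inj₁ grows with growth k
  ...   | inj₁ le = inj₁ (ℕₚ.≤-trans (s≤s le) grows)
  ...   | inj₂ st = inj₂ (stable-suc k st)

  stable-n : Stable n
  stable-n with growth n
  ... | inj₂ st = st
  ... | inj₁ le = ⊥-elim (ℕₚ.<-irrefl refl (ℕₚ.≤-trans le
          (subst (reached n ≤_) (length-tabulate (λ x → x)) (countB≤length _ (allFin n)))))

  reach-ind : (P : Fin n → Set) → P u → (∀ a b → (a , b) ∈ S → (P a → P b) × (P b → P a)) →
    ∀ k x → T (reach k S u x) → P x
  reach-ind P pu cl zero x t = subst P (==→≡ t) pu
  reach-ind P pu cl (suc k) x t with T∨ {reach k S u x} t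
  ... | inj₁ h = reach-ind P pu cl k x h
  ... | inj₂ h with any→ _ S h
  ...   | (a , b) , m , q with T∨ {reach k S u a ∧ (b == x)} q
  ...     | inj₁ r = subst P (==→≡ (T∧₂ r)) (proj₁ (cl a b m) (reach-ind P pu cl k a (T∧₁ r)))
  ...     | inj₂ r = subst P (==→≡ (T∧₂ r)) (proj₂ (cl a b m) (reach-ind P pu cl k b (T∧₁ r)))

open Stabilisation using (stable-n; reach-refl; reach-ind)

conn-refl : ∀ {n} (S : Edges n) x → Conn S x x
conn-refl {n} S x = reach-refl S x n

conn-ind : ∀ {n} (S : Edges n) u (P : Fin n → Set) → P u →
  (∀ a b → (a , b) ∈ S → (P a → P b) × (P b → P a)) → ∀ x → Conn S u x → P x
conn-ind {n} S u P pu cl x = reach-ind S u P pu cl n x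

-- Conn S u is closed under traversing edges of S in either direction, since reach has stabilised.
conn-edgeF : ∀ {n} (S : Edges n) u a b → (a , b) ∈ S → Conn S u a → Conn S u b
conn-edgeF {n} S u a b m t = subst T (stable-n S u b)
  (T∨₂ {reach n S u b} (→any _ m (T∨₁ (T∧ t (≡→== refl)))))

conn-edgeB : ∀ {n} (S : Edges n) u a b → (a , b) ∈ S → Conn S u b → Conn S u a
conn-edgeB {n} S u a b m t = subst T (stable-n S u a)
  (T∨₂ {reach n S u a} (→any _ m (T∨₂ {reach n S u a ∧ (b == a)} (T∧ t (≡→== refl)))))

conn-trans : ∀ {n} (S : Edges n) x y z → Conn S x y → Conn S y z → Conn S x z
conn-trans S x y z p q = conn-ind S y (Conn S x) p
  (λ a b m → conn-edgeF S x a b m , conn-edgeB S x a b m) z q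

conn-edge : ∀ {n} (S : Edges n) a b → (a , b) ∈ S → Conn S a b
conn-edge S a b m = conn-edgeF S a a b m (conn-refl S a)

conn-sym : ∀ {n} (S : Edges n) x y → Conn S x y → Conn S y x
conn-sym S x y p = conn-ind S x (λ z → Conn S z x) (conn-refl S x)
  (λ a b m → conn-trans S b a x (conn-edgeB S b a b m (conn-refl S b)) ,
             conn-trans S a b x (conn-edge S a b m)) y p

conn-mono : ∀ {n} {S S' : Edges n} → S ⊆ S' → ∀ x y → Conn S x y → Conn S' x y
conn-mono {S = S} {S'} sub x y p = conn-ind S x (Conn S' x) (conn-refl S' x)
  (λ a b m → conn-edgeF S' x a b (sub m) , conn-edgeB S' x a b (sub m)) y p

conn-symm : ∀ {n} (S : Edges n) x y → conn S x y ≡ conn S y x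
conn-symm S x y = T-ext (conn-sym S x y) (conn-sym S y x)

conn-nil : ∀ {n} (x y : Fin n) → Conn [] x y → x ≡ y
conn-nil x y = conn-ind [] x (x ≡_) refl (λ _ _ ()) y

-- Deleting an edge ab: a walk in R + ab either avoids ab or passes through it once.
module _ {n : ℕ} (R : Edges n) (a b : Fin n) where

  ConnVia : Fin n → Fin n → Set
  ConnVia x z = Conn R x z ⊎ (Conn R x a × Conn R b z) ⊎ (Conn R x b × Conn R a z)

  conn-remove : ∀ x z → Conn ((a , b) ∷ R) x z → ConnVia x z
  conn-remove x z = conn-ind ((a , b) ∷ R) x (ConnVia x) (inj₁ (conn-refl R x)) closed z
    where
    along : ∀ {c d} → Conn R c d → ConnVia x c → ConnVia x d
    along q (inj₁ p)                = inj₁ (conn-trans R x _ _ p q)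
    along q (inj₂ (inj₁ (p , r)))   = inj₂ (inj₁ (p , conn-trans R b _ _ r q))
    along q (inj₂ (inj₂ (p , r)))   = inj₂ (inj₂ (p , conn-trans R a _ _ r q))
    a→b : ConnVia x a → ConnVia x b
    a→b (inj₁ p)              = inj₂ (inj₁ (p , conn-refl R b))
    a→b (inj₂ (inj₁ (p , r))) = inj₁ (conn-trans R x a b p (conn-sym R b a r))
    a→b (inj₂ (inj₂ (p , r))) = inj₁ p
    b→a : ConnVia x b → ConnVia x a
    b→a (inj₁ p)              = inj₂ (inj₂ (p , conn-refl R a))
    b→a (inj₂ (inj₁ (p , r))) = inj₁ p
    b→a (inj₂ (inj₂ (p , r))) = inj₁ (conn-trans R x b a p (conn-sym R a b r))
    closed : ∀ c d → (c , d) ∈ ((a , b) ∷ R) → (ConnVia x c → ConnVia x d) × (ConnVia x d → ConnVia x c)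
    closed c d (here refl) = a→b , b→a
    closed c d (there m)   = along (conn-edge R c d m) , along (conn-sym R c d (conn-edge R c d m))

Inside : ∀ {n} → (Fin n → Bool) → Edges n → Set
Inside W S = ∀ a b → (a , b) ∈ S → T (W a) × T (W b)

Inside-⊆ : ∀ {n} W {A B : Edges n} → A ⊆ B → Inside W B → Inside W A
Inside-⊆ W sub ins a b m = ins a b (sub m)

conn-comm : ∀ {n} (A B : Edges n) x y → Conn (A ++ B) x y → Conn (B ++ A) x y
conn-comm A B = conn-mono (⊆-reflexive-↭ (++-comm A B))

-- A walk in T₁ ++ T₂ from a vertex x of W₁ is cut at its visits to i and j; its pieces are
-- walks inside one side.  Reach₁ x y describes reaching y ∈ W₁, Reach₂ x y reaching y ∈ W₂.
module Glue {n : ℕ} (W₁ W₂ : Fin n → Bool) (T₁ T₂ : Edges n)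
  (ins₁ : Inside W₁ T₁) (ins₂ : Inside W₂ T₂) (i j : Fin n)
  (sep : ∀ x → T (W₁ x) → T (W₂ x) → x ≡ i ⊎ x ≡ j) where

  C₁ = Conn T₁
  C₂ = Conn T₂
  C  = Conn (T₁ ++ T₂)

  Reach₁ : Fin n → Fin n → Set
  Reach₁ x y = C₁ x y ⊎ (C₂ i j × ((C₁ x i × C₁ j y) ⊎ (C₁ x j × C₁ i y)))

  Reach₂ : Fin n → Fin n → Set
  Reach₂ x y = (Reach₁ x i × C₂ i y) ⊎ (Reach₁ x j × C₂ j y)

  Reach₁-ext : ∀ x a b → Reach₁ x a → C₁ a b → Reach₁ x b
  Reach₁-ext x a b (inj₁ p) q                     = inj₁ (conn-trans T₁ x a b p q)
  Reach₁-ext x a b (inj₂ (c , inj₁ (p , r))) q = inj₂ (c , inj₁ (p , conn-trans T₁ j a b r q))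
  Reach₁-ext x a b (inj₂ (c , inj₂ (p , r))) q = inj₂ (c , inj₂ (p , conn-trans T₁ i a b r q))

  Reach₂-ext : ∀ x a b → Reach₂ x a → C₂ a b → Reach₂ x b
  Reach₂-ext x a b (inj₁ (g , p)) q = inj₁ (g , conn-trans T₂ i a b p q)
  Reach₂-ext x a b (inj₂ (g , p)) q = inj₂ (g , conn-trans T₂ j a b p q)

  Reach₁-sep : ∀ x → Reach₁ x i ⊎ Reach₁ x j → C₁ x i ⊎ C₁ x j
  Reach₁-sep x (inj₁ (inj₁ p))                = inj₁ p
  Reach₁-sep x (inj₁ (inj₂ (_ , inj₁ (p , _)))) = inj₁ p
  Reach₁-sep x (inj₁ (inj₂ (_ , inj₂ (p , _)))) = inj₂ p
  Reach₁-sep x (inj₂ (inj₁ p))                = inj₂ p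
  Reach₁-sep x (inj₂ (inj₂ (_ , inj₁ (p , _)))) = inj₁ p
  Reach₁-sep x (inj₂ (inj₂ (_ , inj₂ (p , _)))) = inj₂ p

  Reach₁-bridge : ∀ x → C₂ i j → C₁ x i ⊎ C₁ x j → Reach₁ x i × Reach₁ x j
  Reach₁-bridge x c (inj₁ p) = inj₁ p , inj₂ (c , inj₁ (p , conn-refl T₁ j))
  Reach₁-bridge x c (inj₂ p) = inj₂ (c , inj₂ (p , conn-refl T₁ i)) , inj₁ p

  Reach₂→Reach₁ : ∀ x b → b ≡ i ⊎ b ≡ j → Reach₂ x b → Reach₁ x b
  Reach₂→Reach₁ x b (inj₁ refl) (inj₁ (g , _)) = g
  Reach₂→Reach₁ x b (inj₁ refl) (inj₂ (g , c)) =
    proj₁ (Reach₁-bridge x (conn-sym T₂ j i c) (Reach₁-sep x (inj₂ g)))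
  Reach₂→Reach₁ x b (inj₂ refl) (inj₁ (g , c)) = proj₂ (Reach₁-bridge x c (Reach₁-sep x (inj₁ g)))
  Reach₂→Reach₁ x b (inj₂ refl) (inj₂ (g , _)) = g

  Reach₁→Reach₂ : ∀ x b → b ≡ i ⊎ b ≡ j → Reach₁ x b → Reach₂ x b
  Reach₁→Reach₂ x b (inj₁ refl) g = inj₁ (g , conn-refl T₂ i)
  Reach₁→Reach₂ x b (inj₂ refl) g = inj₂ (g , conn-refl T₂ j)

  module _ (x : Fin n) (wx : T (W₁ x)) where

    -- the invariant carried along a walk from x
    Reachable : Fin n → Set
    Reachable z = (T (W₁ z) → Reach₁ x z) × (T (W₂ z) → Reach₂ x z)

    along₁ : ∀ a b → T (W₁ a) → T (W₁ b) → C₁ a b → Reachable a → Reachable b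
    along₁ a b wa wb q ra = (λ _ → rb) , λ w₂ → Reach₁→Reach₂ x b (sep b wb w₂) rb
      where rb = Reach₁-ext x a b (proj₁ ra wa) q

    along₂ : ∀ a b → T (W₂ a) → T (W₂ b) → C₂ a b → Reachable a → Reachable b
    along₂ a b wa wb q ra = (λ w₁ → Reach₂→Reach₁ x b (sep b w₁ wb) rb) , λ _ → rb
      where rb = Reach₂-ext x a b (proj₂ ra wa) q

    glue : ∀ z → C x z → Reachable z
    glue = conn-ind (T₁ ++ T₂) x Reachable start closed
      where
      start : Reachable x
      start = (λ _ → inj₁ (conn-refl T₁ x)) ,
              λ w₂ → Reach₁→Reach₂ x x (sep x wx w₂) (inj₁ (conn-refl T₁ x))
      closed : ∀ a b → (a , b) ∈ (T₁ ++ T₂) → (Reachable a → Reachable b) × (Reachable b → Reachable a)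
      closed a b m with ∈-++⁻ T₁ m
      ... | inj₁ m₁ = let (wa , wb) = ins₁ a b m₁ ; q = conn-edge T₁ a b m₁ in
          along₁ a b wa wb q , along₁ b a wb wa (conn-sym T₁ a b q)
      ... | inj₂ m₂ = let (wa , wb) = ins₂ a b m₂ ; q = conn-edge T₂ a b m₂ in
          along₂ a b wa wb q , along₂ b a wb wa (conn-sym T₂ a b q)

  C₁→C : ∀ x y → C₁ x y → C x y
  C₁→C = conn-mono (xs⊆xs++ys T₁ T₂)

  C₂→C : ∀ x y → C₂ x y → C x y
  C₂→C = conn-mono (xs⊆ys++xs T₂ T₁)

  Reach₁→C : ∀ x y → Reach₁ x y → C x y
  Reach₁→C x y (inj₁ p) = C₁→C x y p
  Reach₁→C x y (inj₂ (c , inj₁ (p , r))) =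
    conn-trans _ x i y (C₁→C x i p) (conn-trans _ i j y (C₂→C i j c) (C₁→C j y r))
  Reach₁→C x y (inj₂ (c , inj₂ (p , r))) =
    conn-trans _ x j y (C₁→C x j p) (conn-trans _ j i y (conn-sym _ i j (C₂→C i j c)) (C₁→C i y r))

  conn-across : ∀ x → T (W₁ x) → T (W₁ i) →
    conn (T₁ ++ T₂) x i ≡ (conn T₁ x i ∨ (conn T₁ x j ∧ conn T₂ i j))
  conn-across x wx wi = T-ext (λ t → out (proj₁ (glue x wx i t) wi)) (λ t → into (T∨ t))
    where
    out : Reach₁ x i → T (conn T₁ x i ∨ (conn T₁ x j ∧ conn T₂ i j))
    out (inj₁ p)                = T∨₁ p
    out (inj₂ (c , inj₁ (p , _))) = T∨₁ p
    out (inj₂ (c , inj₂ (p , _))) = T∨₂ {conn T₁ x i} (T∧ p c)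
    into : T (conn T₁ x i) ⊎ T (conn T₁ x j ∧ conn T₂ i j) → C x i
    into (inj₁ p) = C₁→C x i p
    into (inj₂ p) = conn-trans _ x j i (C₁→C x j (T∧₁ p))
                      (conn-sym _ i j (C₂→C i j (T∧₂ {conn T₁ x j} p)))

Acyclic : ∀ {n} → Edges n → Set
Acyclic S = ∀ e r → (e , r) ∈ splits S → ¬ Conn r (proj₁ e) (proj₂ e)

acyclic→Acyclic : ∀ {n} (S : Edges n) → T (acyclic S) → Acyclic S
acyclic→Acyclic S t e r m = Tnot⁻ (All.lookup (all⁺ _ (splits S) t) m)

Acyclic→acyclic : ∀ {n} (S : Edges n) → Acyclic S → T (acyclic S)
Acyclic→acyclic S h = all⁻ _ (All.tabulate (λ {p} m → Tnot (h (proj₁ p) (proj₂ p) m)))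

splits-∈ : ∀ {A : Set} (s : List A) {e} → e ∈ s → Σ (List A) λ r → (e , r) ∈ splits s × s ↭ e ∷ r
splits-∈ (x ∷ s) (here refl) = s , here refl , ↭-refl
splits-∈ (x ∷ s) {e} (there m) with splits-∈ s m
... | r , mr , p = x ∷ r , there (∈-map⁺ _ mr) , ↭-trans (prep x p) (swap x e ↭-refl)

splits-↭ : ∀ {A : Set} (s : List A) {e r} → (e , r) ∈ splits s → s ↭ e ∷ r
splits-↭ (x ∷ s) (here refl) = ↭-refl
splits-↭ (x ∷ s) (there m) with ∈-map⁻ _ m
... | (e' , r') , m' , refl = ↭-trans (prep x (splits-↭ s m')) (swap x e' ↭-refl)

splits-rest : ∀ {A : Set} (s : List A) {e r} → (e , r) ∈ splits s → r ⊆ s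
splits-rest s m = ⊆-reflexive-↭ (↭-sym (splits-↭ s m)) ∘ there

splits-elem : ∀ {A : Set} (s : List A) {e r} → (e , r) ∈ splits s → e ∈ s
splits-elem s m = ⊆-reflexive-↭ (↭-sym (splits-↭ s m)) (here refl)

splits-++ : ∀ {A : Set} (s₁ s₂ : List A) → splits (s₁ ++ s₂) ≡
  map (λ p → proj₁ p , proj₂ p ++ s₂) (splits s₁) ++ map (λ p → proj₁ p , s₁ ++ proj₂ p) (splits s₂)
splits-++ [] s₂ = sym (map-id (splits s₂))
splits-++ (x ∷ s₁) s₂ = cong ((x , s₁ ++ s₂) ∷_) (begin
    map f (splits (s₁ ++ s₂))
  ≡⟨ cong (map f) (splits-++ s₁ s₂) ⟩
    map f (map g (splits s₁) ++ map h (splits s₂))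
  ≡⟨ map-++ f (map g (splits s₁)) (map h (splits s₂)) ⟩
    map f (map g (splits s₁)) ++ map f (map h (splits s₂))
  ≡⟨ cong₂ _++_ (trans (sym (map-∘ (splits s₁))) (map-∘ (splits s₁))) (sym (map-∘ (splits s₂))) ⟩
    map g (map f (splits s₁)) ++ map (λ p → proj₁ p , (x ∷ s₁) ++ proj₂ p) (splits s₂)
  ∎)
  where
  open ≡-Reasoning
  f = λ (p : _ × List _) → proj₁ p , x ∷ proj₂ p
  g = λ (p : _ × List _) → proj₁ p , proj₂ p ++ s₂
  h = λ (p : _ × List _) → proj₁ p , s₁ ++ proj₂ p

splits-++⁻ : ∀ {A : Set} (s₁ s₂ : List A) {e r} → (e , r) ∈ splits (s₁ ++ s₂) →
  (Σ (List A) λ r₁ → (e , r₁) ∈ splits s₁ × r ≡ r₁ ++ s₂) ⊎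
  (Σ (List A) λ r₂ → (e , r₂) ∈ splits s₂ × r ≡ s₁ ++ r₂)
splits-++⁻ s₁ s₂ m with ∈-++⁻ (map (λ p → proj₁ p , proj₂ p ++ s₂) (splits s₁)) (subst (_ ∈_) (splits-++ s₁ s₂) m)
... | inj₁ m₁ with ∈-map⁻ _ m₁
...   | (_ , r₁) , m' , refl = inj₁ (r₁ , m' , refl)
splits-++⁻ s₁ s₂ m | inj₂ m₂ with ∈-map⁻ _ m₂
...   | (_ , r₂) , m' , refl = inj₂ (r₂ , m' , refl)

splits-++⁺ˡ : ∀ {A : Set} (s₁ s₂ : List A) {e r} → (e , r) ∈ splits s₁ → (e , r ++ s₂) ∈ splits (s₁ ++ s₂)
splits-++⁺ˡ s₁ s₂ m = subst (_ ∈_) (sym (splits-++ s₁ s₂)) (∈-++⁺ˡ (∈-map⁺ _ m))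

splits-++⁺ʳ : ∀ {A : Set} (s₁ s₂ : List A) {e r} → (e , r) ∈ splits s₂ → (e , s₁ ++ r) ∈ splits (s₁ ++ s₂)
splits-++⁺ʳ s₁ s₂ m = subst (_ ∈_) (sym (splits-++ s₁ s₂)) (∈-++⁺ʳ (map (λ p → proj₁ p , proj₂ p ++ s₂) (splits s₁)) (∈-map⁺ _ m))

Acyclic-↭ : ∀ {n} {S S' : Edges n} → S ↭ S' → Acyclic S → Acyclic S'
Acyclic-↭ {S = S} {S'} p h e r' m c with splits-∈ S (⊆-reflexive-↭ (↭-sym p) (splits-elem S' m))
... | r , mr , q = h e r mr (conn-mono (⊆-reflexive-↭ (↭-sym r↭r')) _ _ c)
  where
  r↭r' : r ↭ r'
  r↭r' = drop-∷ (↭-trans (↭-sym q) (↭-trans p (splits-↭ S' m)))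

acyclic-↭ : ∀ {n} {S S' : Edges n} → S ↭ S' → acyclic S ≡ acyclic S'
acyclic-↭ {S = S} {S'} p =
  T-ext (λ t → Acyclic→acyclic S' (Acyclic-↭ p (acyclic→Acyclic S t)))
        (λ t → Acyclic→acyclic S (Acyclic-↭ (↭-sym p) (acyclic→Acyclic S' t)))

-- If no edge of the forest s lies on a cycle of s ++ R and R joins i to j, then s does not:
-- otherwise the first edge of an i–j path in s would close a cycle with R.
not-both-join : ∀ {n} (i j : Fin n) → i ≢ j → (R s : Edges n) →
  (∀ e r → (e , r) ∈ splits s → ¬ Conn (r ++ R) (proj₁ e) (proj₂ e)) →
  Conn R i j → ¬ Conn s i j
not-both-join i j i≢j R [] h c c' = i≢j (conn-nil i j c')
not-both-join i j i≢j R ((a , b) ∷ s) h c c' with conn-remove s a b i j c'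
... | inj₁ q = not-both-join i j i≢j R s
      (λ e r m → h e ((a , b) ∷ r) (there (∈-map⁺ _ m)) ∘ conn-mono (xs⊆x∷xs (r ++ R) (a , b)) _ _) c q
... | inj₂ (inj₁ (p , q)) = h (a , b) s (here refl)
      (conn-trans S a i b (conn-sym S i a (inS i a p))
        (conn-trans S i j b (conn-mono (xs⊆ys++xs R s) i j c) (conn-sym S b j (inS b j q))))
  where S = s ++ R
        inS = conn-mono (xs⊆xs++ys s R)
... | inj₂ (inj₂ (p , q)) = h (a , b) s (here refl)
      (conn-trans S a j b (inS a j q)
        (conn-trans S j i b (conn-sym S i j (conn-mono (xs⊆ys++xs R s) i j c)) (inS i b p)))
  where S = s ++ R
        inS = conn-mono (xs⊆xs++ys s R)

-- Across a separator {i, j}: an edge of s₁ on a cycle of s₁ ++ s₂ either lies on a cycle of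
-- s₁, or the cycle crosses the separator, in which case s₁ and s₂ both join i and j.
cycle-across : ∀ {n} (W₁ W₂ : Fin n → Bool) (s₁ s₂ : Edges n) → Inside W₁ s₁ → Inside W₂ s₂ →
  (i j : Fin n) → (∀ x → T (W₁ x) → T (W₂ x) → x ≡ i ⊎ x ≡ j) →
  Acyclic s₁ → ¬ (Conn s₁ i j × Conn s₂ i j) →
  ∀ e r₁ → (e , r₁) ∈ splits s₁ → ¬ Conn (r₁ ++ s₂) (proj₁ e) (proj₂ e)
cycle-across W₁ W₂ s₁ s₂ ins₁ ins₂ i j sep ac no-ij (a , b) r₁ m c
  with proj₁ (Glue.glue W₁ W₂ r₁ s₂ (Inside-⊆ W₁ (splits-rest s₁ m) ins₁) ins₂ i j sep a wa b c) wb
  where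
  wa = proj₁ (ins₁ a b (splits-elem s₁ m))
  wb = proj₂ (ins₁ a b (splits-elem s₁ m))
... | inj₁ q = ac (a , b) r₁ m q
... | inj₂ (c₂ , inj₁ (p , q)) = no-ij (conn-trans s₁ i a j (conn-sym s₁ a i (inS a i p))
                                   (conn-trans s₁ a b j ab (conn-sym s₁ j b (inS j b q))) , c₂)
  where inS = conn-mono (splits-rest s₁ m)
        ab = conn-edge s₁ a b (splits-elem s₁ m)
... | inj₂ (c₂ , inj₂ (p , q)) = no-ij (conn-trans s₁ i b j (inS i b q)
                                   (conn-trans s₁ b a j (conn-sym s₁ a b ab) (inS a j p)) , c₂)
  where inS = conn-mono (splits-rest s₁ m)
        ab = conn-edge s₁ a b (splits-elem s₁ m)

acyclic-union : ∀ {n} (W₁ W₂ : Fin n → Bool) (s₁ s₂ : Edges n) → Inside W₁ s₁ → Inside W₂ s₂ →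
  (i j : Fin n) → i ≢ j → (∀ x → T (W₁ x) → T (W₂ x) → x ≡ i ⊎ x ≡ j) →
  acyclic (s₁ ++ s₂) ≡ (acyclic s₁ ∧ acyclic s₂ ∧ not (conn s₁ i j ∧ conn s₂ i j))
acyclic-union W₁ W₂ s₁ s₂ ins₁ ins₂ i j i≢j sep = T-ext
  (λ t → let ac = acyclic→Acyclic _ t in
     T∧ (Acyclic→acyclic s₁ (restrict₁ ac)) (T∧ (Acyclic→acyclic s₂ (restrict₂ ac))
       (Tnot (λ both → not-both-join i j i≢j s₂ s₁ (first ac) (T∧₂ {conn s₁ i j} both) (T∧₁ both)))))
  (λ t → let t' = T∧₂ {acyclic s₁} t in
     Acyclic→acyclic _ (union (acyclic→Acyclic s₁ (T∧₁ t)) (acyclic→Acyclic s₂ (T∧₁ t'))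
       (λ (c₁ , c₂) → Tnot⁻ (T∧₂ {acyclic s₂} t') (T∧ c₁ c₂))))
  where
  first : Acyclic (s₁ ++ s₂) → ∀ e r → (e , r) ∈ splits s₁ → ¬ Conn (r ++ s₂) (proj₁ e) (proj₂ e)
  first h e r m = h e (r ++ s₂) (splits-++⁺ˡ s₁ s₂ m)
  restrict₁ : Acyclic (s₁ ++ s₂) → Acyclic s₁
  restrict₁ h e r m = first h e r m ∘ conn-mono (xs⊆xs++ys r s₂) _ _
  restrict₂ : Acyclic (s₁ ++ s₂) → Acyclic s₂
  restrict₂ h e r m = h e (s₁ ++ r) (splits-++⁺ʳ s₁ s₂ m) ∘ conn-mono (xs⊆ys++xs r s₁) _ _
  union : Acyclic s₁ → Acyclic s₂ → ¬ (Conn s₁ i j × Conn s₂ i j) → Acyclic (s₁ ++ s₂)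
  union ac₁ ac₂ no-ij e r m with splits-++⁻ s₁ s₂ m
  ... | inj₁ (r₁ , m₁ , refl) = cycle-across W₁ W₂ s₁ s₂ ins₁ ins₂ i j sep ac₁ no-ij e r₁ m₁
  ... | inj₂ (r₂ , m₂ , refl) = cycle-across W₂ W₁ s₂ s₁ ins₂ ins₁ i j (λ x w₂ w₁ → sep x w₁ w₂) ac₂
          (λ (c₂ , c₁) → no-ij (c₁ , c₂)) e r₂ m₂ ∘ conn-comm s₁ r₂ _ _

subsets-⊆ : ∀ {A : Set} (E : List A) {s} → s ∈ subsets E → s ⊆ E
subsets-⊆ [] (here refl) ()
subsets-⊆ (x ∷ E) m e∈s with ∈-++⁻ (subsets E) m
... | inj₁ m₁ = there (subsets-⊆ E m₁ e∈s)
... | inj₂ m₂ with ∈-map⁻ (x ∷_) m₂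
...   | s' , m' , refl with e∈s
...     | here refl = here refl
...     | there e∈s' = there (subsets-⊆ E m' e∈s')

count-subsets-∷ : ∀ {A : Set} (p : List A → Bool) x xs →
  countB p (subsets (x ∷ xs)) ≡ countB p (subsets xs) ℕ.+ countB (p ∘ (x ∷_)) (subsets xs)
count-subsets-∷ p x xs =
  trans (countB-++ p (subsets xs) _) (cong (countB p (subsets xs) ℕ.+_) (countB-map p (x ∷_) (subsets xs)))

Respects↭ : ∀ {A : Set} → (List A → Bool) → Set
Respects↭ p = ∀ {s s'} → s ↭ s' → p s ≡ p s'

count-subsets-↭ : ∀ {A : Set} {xs ys : List A} → xs ↭ ys → (p : List A → Bool) → Respects↭ p →
  countB p (subsets xs) ≡ countB p (subsets ys)
count-subsets-↭ ↭.refl p rp = refl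
count-subsets-↭ {xs = x ∷ xs} {x ∷ ys} (prep x q) p rp =
  trans (count-subsets-∷ p x xs) (trans
    (cong₂ ℕ._+_ (count-subsets-↭ q p rp) (count-subsets-↭ q (p ∘ (x ∷_)) (rp ∘ prep x)))
    (sym (count-subsets-∷ p x ys)))
count-subsets-↭ {xs = x ∷ y ∷ xs} {y ∷ x ∷ ys} (swap x y q) p rp = begin
    c (x ∷ y ∷ xs) p
  ≡⟨ expand x y xs p ⟩
    (c xs p ℕ.+ c xs (p ∘ (y ∷_))) ℕ.+ (c xs (p ∘ (x ∷_)) ℕ.+ c xs (p ∘ (λ s → x ∷ y ∷ s)))
  ≡⟨ cong₂ ℕ._+_ (cong₂ ℕ._+_ (IH p rp) (IH (p ∘ (y ∷_)) (rp ∘ prep y)))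
                 (cong₂ ℕ._+_ (IH (p ∘ (x ∷_)) (rp ∘ prep x))
                    (trans (IH _ (rp ∘ prep x ∘ prep y))
                       (countB-cong _ _ (subsets ys) (λ _ → rp (swap x y ↭-refl))))) ⟩
    (c ys p ℕ.+ c ys (p ∘ (y ∷_))) ℕ.+ (c ys (p ∘ (x ∷_)) ℕ.+ c ys (p ∘ (λ s → y ∷ x ∷ s)))
  ≡⟨ interchange (c ys p) (c ys (p ∘ (y ∷_))) (c ys (p ∘ (x ∷_))) _ ⟩
    (c ys p ℕ.+ c ys (p ∘ (x ∷_))) ℕ.+ (c ys (p ∘ (y ∷_)) ℕ.+ c ys (p ∘ (λ s → y ∷ x ∷ s)))
  ≡⟨ sym (expand y x ys p) ⟩
    c (y ∷ x ∷ ys) p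
  ∎
  where
  open ≡-Reasoning
  c : List _ → (List _ → Bool) → ℕ
  c zs q = countB q (subsets zs)
  IH : ∀ r → Respects↭ r → c xs r ≡ c ys r
  IH r rr = count-subsets-↭ q r rr
  expand : ∀ a b zs q → c (a ∷ b ∷ zs) q ≡
    (c zs q ℕ.+ c zs (q ∘ (b ∷_))) ℕ.+ (c zs (q ∘ (a ∷_)) ℕ.+ c zs (q ∘ (λ s → a ∷ b ∷ s)))
  expand a b zs q = trans (count-subsets-∷ q a (b ∷ zs))
    (cong₂ ℕ._+_ (count-subsets-∷ q b zs) (count-subsets-∷ (q ∘ (a ∷_)) b zs))
count-subsets-↭ (↭.trans q r) p rp = trans (count-subsets-↭ q p rp) (count-subsets-↭ r p rp)

⟦_⟧ : Bool → ℤ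
⟦ true ⟧  = 1ℤ
⟦ false ⟧ = 0ℤ

∑ : ∀ {A : Set} → List A → (A → ℤ) → ℤ
∑ [] f       = 0ℤ
∑ (x ∷ xs) f = f x + ∑ xs f

countB-∑ : ∀ {A : Set} (p : A → Bool) xs → + countB p xs ≡ ∑ xs (λ x → ⟦ p x ⟧)
countB-∑ p [] = refl
countB-∑ p (x ∷ xs) with p x
... | true  = cong (_+_ 1ℤ) (countB-∑ p xs)
... | false = trans (countB-∑ p xs) (sym (ℤₚ.+-identityˡ _))

∑-cong : ∀ {A : Set} xs (f g : A → ℤ) → (∀ {x} → x ∈ xs → f x ≡ g x) → ∑ xs f ≡ ∑ xs g
∑-cong [] f g h = refl
∑-cong (x ∷ xs) f g h = cong₂ _+_ (h (here refl)) (∑-cong xs f g (h ∘ there))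

∑-++ : ∀ {A : Set} xs ys (f : A → ℤ) → ∑ (xs ++ ys) f ≡ ∑ xs f + ∑ ys f
∑-++ [] ys f = sym (ℤₚ.+-identityˡ _)
∑-++ (x ∷ xs) ys f = trans (cong (_+_ (f x)) (∑-++ xs ys f)) (sym (ℤₚ.+-assoc (f x) _ _))

∑-map : ∀ {A B : Set} (g : A → B) xs (f : B → ℤ) → ∑ (map g xs) f ≡ ∑ xs (f ∘ g)
∑-map g [] f = refl
∑-map g (x ∷ xs) f = cong (_+_ (f (g x))) (∑-map g xs f)

∑-+ : ∀ {A : Set} xs (f g : A → ℤ) → ∑ xs (λ x → f x + g x) ≡ ∑ xs f + ∑ xs g
∑-+ [] f g = refl
∑-+ (x ∷ xs) f g =
  trans (cong (_+_ (f x + g x)) (∑-+ xs f g)) (ℤ-interchange (f x) (g x) (∑ xs f) (∑ xs g))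

∑-*ˡ : ∀ {A : Set} xs c (f : A → ℤ) → ∑ xs (λ x → c * f x) ≡ c * ∑ xs f
∑-*ˡ [] c f = sym (ℤₚ.*-zeroʳ c)
∑-*ˡ (x ∷ xs) c f = trans (cong (_+_ (c * f x)) (∑-*ˡ xs c f)) (sym (ℤₚ.*-distribˡ-+ c (f x) _))

∑-neg : ∀ {A : Set} xs (f : A → ℤ) → ∑ xs (λ x → - f x) ≡ - ∑ xs f
∑-neg [] f = refl
∑-neg (x ∷ xs) f = trans (cong (_+_ (- f x)) (∑-neg xs f)) (sym (ℤₚ.neg-distrib-+ (f x) _))

∑-product : ∀ {A B : Set} xs ys (f : A → ℤ) (g : B → ℤ) →
  ∑ xs f * ∑ ys g ≡ ∑ xs (λ x → ∑ ys (λ y → f x * g y))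
∑-product xs ys f g = begin
    ∑ xs f * ∑ ys g                      ≡⟨ ℤₚ.*-comm (∑ xs f) _ ⟩
    ∑ ys g * ∑ xs f                      ≡⟨ sym (∑-*ˡ xs (∑ ys g) f) ⟩
    ∑ xs (λ x → ∑ ys g * f x)            ≡⟨ ∑-cong xs _ _ (λ {x} _ → ℤₚ.*-comm (∑ ys g) (f x)) ⟩
    ∑ xs (λ x → f x * ∑ ys g)            ≡⟨ ∑-cong xs _ _ (λ {x} _ → sym (∑-*ˡ ys (f x) g)) ⟩
    ∑ xs (λ x → ∑ ys (λ y → f x * g y))  ∎
  where open ≡-Reasoning

count-subsets-++ : ∀ {A : Set} (p : List A → Bool) xs ys →
  + countB p (subsets (xs ++ ys)) ≡ ∑ (subsets xs) (λ s₁ → ∑ (subsets ys) (λ s₂ → ⟦ p (s₁ ++ s₂) ⟧))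
count-subsets-++ p [] ys = trans (countB-∑ p (subsets ys)) (sym (ℤₚ.+-identityʳ _))
count-subsets-++ p (x ∷ xs) ys = begin
    + countB p (subsets (x ∷ xs ++ ys))
  ≡⟨ cong +_ (count-subsets-∷ p x (xs ++ ys)) ⟩
    + countB p (subsets (xs ++ ys)) + + countB (p ∘ (x ∷_)) (subsets (xs ++ ys))
  ≡⟨ cong₂ _+_ (count-subsets-++ p xs ys) (count-subsets-++ (p ∘ (x ∷_)) xs ys) ⟩
    ∑ (subsets xs) F + ∑ (subsets xs) (F ∘ (x ∷_))
  ≡⟨ cong (_+_ (∑ (subsets xs) F)) (sym (∑-map (x ∷_) (subsets xs) F)) ⟩
    ∑ (subsets xs) F + ∑ (map (x ∷_) (subsets xs)) F
  ≡⟨ sym (∑-++ (subsets xs) _ F) ⟩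
    ∑ (subsets (x ∷ xs)) F
  ∎
  where
  open ≡-Reasoning
  F = λ s₁ → ∑ (subsets ys) (λ s₂ → ⟦ p (s₁ ++ s₂) ⟧)

reassoc : ∀ f c g t → (f ∧ g ∧ (c ∧ t)) ≡ ((f ∧ c) ∧ g ∧ t)
reassoc = solve 4 (λ f c g t → f ⊕ g ⊕ (c ⊕ t) ⊜ (f ⊕ c) ⊕ g ⊕ t) refl

-- Relative to a terminal w and the separator {i, j}, what matters about an edge set
-- s of one side H is whether s is a forest each of whose components meets {w, i, j}, and the
-- pattern (w ∼ i, w ∼ j, i ∼ j) in which s connects these three vertices.

Pattern : Set
Pattern = Bool × Bool × Bool

Profile : Set
Profile = Bool × Pattern

Coherent : Pattern → Set
Coherent (a , b , c) = (T a → T b → T c) × (T a → T c → T b) × (T b → T c → T a)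

-- The counts in the theorem, as conditions on the profile of an edge set of one side:
-- spanning trees, 2-forests separating w from i (resp. j), those among the former in which
-- i ∼ j, and forests with three components separating w, i, j (these become the 2-forests of
-- the contraction H/ij separating w from ij).
isTree sepWI sepWJ sepW-IJ apart : Profile → Bool
isTree  (g , a , b , c) = g ∧ a ∧ b
sepWI   (g , a , b , c) = g ∧ not a ∧ (b ∨ c)
sepWJ   (g , a , b , c) = g ∧ not b ∧ (a ∨ c)
sepW-IJ (g , a , b , c) = sepWI (g , a , b , c) ∧ c
apart   (g , a , b , c) = g ∧ not a ∧ not b ∧ not c

Covered : ∀ {n} → RawGraph n → Edges n → Fin n → Fin n → Fin n → Bool
Covered H s a b c = forallV H (λ x → conn s a x ∨ conn s b x ∨ conn s c x)

covered→ : ∀ {n} (H : RawGraph n) s a b c → T (Covered H s a b c) →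
  ∀ x → T (V H x) → Conn s a x ⊎ Conn s b x ⊎ Conn s c x
covered→ H s a b c t x vx with T∨ (forallV→ H _ t x vx)
... | inj₁ p = inj₁ p
... | inj₂ q = inj₂ (T∨ q)

→covered : ∀ {n} (H : RawGraph n) s a b c →
  (∀ x → T (V H x) → Conn s a x ⊎ Conn s b x ⊎ Conn s c x) → T (Covered H s a b c)
→covered H s a b c f = →forallV H _ λ x vx → join (f x vx)
  where
  join : ∀ {x} → Conn s a x ⊎ Conn s b x ⊎ Conn s c x → T (conn s a x ∨ conn s b x ∨ conn s c x)
  join (inj₁ p)        = T∨₁ p
  join (inj₂ (inj₁ p)) = T∨₂ {conn s a _} (T∨₁ p)
  join (inj₂ (inj₂ p)) = T∨₂ {conn s a _} (T∨₂ {conn s b _} p)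

covered-by-two : ∀ {n} (H : RawGraph n) s w a b → T (V H b) →
  forallV H (λ x → conn s w x ∨ conn s a x) ≡ (Covered H s w a b ∧ (conn s w b ∨ conn s a b))
covered-by-two H s w a b vb = T-ext
  (λ t → T∧ (→covered H s w a b (λ x vx → either inj₁ (inj₂ ∘ inj₁) (T∨ {conn s w x} (forallV→ H _ t x vx))))
            (forallV→ H _ t b vb))
  (λ t → →forallV H _ λ x vx → via (covered→ H s w a b (T∧₁ t) x vx) (T∨ (T∧₂ {Covered H s w a b} t)))
  where
  via : ∀ {x} → Conn s w x ⊎ Conn s a x ⊎ Conn s b x → Conn s w b ⊎ Conn s a b →
    T (conn s w x ∨ conn s a x)
  via (inj₁ p)        _        = T∨₁ p
  via {x} (inj₂ (inj₁ p)) _    = T∨₂ {conn s w x} p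
  via (inj₂ (inj₂ p)) (inj₁ q) = T∨₁ (conn-trans s w b _ q p)
  via {x} (inj₂ (inj₂ p)) (inj₂ q) = T∨₂ {conn s w x} (conn-trans s a b x q p)

module SideProfile {n : ℕ} (H : RawGraph n) (w i j : Fin n)
  (vw : T (V H w)) (vi : T (V H i)) (vj : T (V H j)) (s : Edges n) where

  Cov : Bool
  Cov = Covered H s w i j

  profile : Profile
  profile = acyclic s ∧ Cov , conn s w i , conn s w j , conn s i j

  coherent : Coherent (proj₂ profile)
  coherent = (λ a b → conn-trans s i w j (conn-sym s w i a) b) ,
             (λ a c → conn-trans s w i j a c) ,
             (λ b c → conn-trans s w j i b (conn-sym s i j c))

  connects-all : forallV H (λ x → forallV H (λ y → conn s x y)) ≡ (Cov ∧ conn s w i ∧ conn s w j)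
  connects-all = T-ext
    (λ t → let joined = λ x y vx vy → forallV→ H _ (forallV→ H _ t x vx) y vy in
      T∧ (→covered H s w i j (λ x vx → inj₁ (joined w x vw vx)))
         (T∧ (joined w i vw vi) (joined w j vw vj)))
    (λ t → let wi = T∧₁ (T∧₂ {Cov} t) ; wj = T∧₂ {conn s w i} (T∧₂ {Cov} t)
               from-w : ∀ x → T (V H x) → Conn s w x
               from-w x vx = either (λ p → p) (either (conn-trans s w i x wi) (conn-trans s w j x wj))
                               (covered→ H s w i j (T∧₁ t) x vx)
           in →forallV H _ λ x vx → →forallV H _ λ y vy →
                conn-trans s x w y (conn-sym s w x (from-w x vx)) (from-w y vy))

  covered-w-j : forallV H (λ x → conn s w x ∨ conn s j x) ≡ (Cov ∧ (conn s w i ∨ conn s i j))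
  covered-w-j = begin
      forallV H (λ x → conn s w x ∨ conn s j x)
    ≡⟨ covered-by-two H s w j i vi ⟩
      Covered H s w j i ∧ (conn s w i ∨ conn s j i)
    ≡⟨ cong₂ (λ c d → c ∧ (conn s w i ∨ d))
         (forallV-cong H _ _ (λ x → cong (conn s w x ∨_) (∨-comm (conn s j x) (conn s i x))))
         (conn-symm s j i) ⟩
      Cov ∧ (conn s w i ∨ conn s i j)
    ∎
    where open ≡-Reasoning

  tree-profile : isSpanningTree H s ≡ isTree profile
  tree-profile = trans (cong (acyclic s ∧_) connects-all) (sym (∧-assoc (acyclic s) Cov _))

  sepWI-profile : isF2 H w i s ≡ sepWI profile
  sepWI-profile = trans (cong (λ z → acyclic s ∧ not (conn s w i) ∧ z) (covered-by-two H s w i j vj))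
    (reassoc (acyclic s) Cov (not (conn s w i)) _)

  sepWJ-profile : isF2 H w j s ≡ sepWJ profile
  sepWJ-profile = trans (cong (λ z → acyclic s ∧ not (conn s w j) ∧ z) covered-w-j)
    (reassoc (acyclic s) Cov (not (conn s w j)) _)

  sepW-IJ-profile : (isF2 H w i s ∧ conn s i j) ≡ sepW-IJ profile
  sepW-IJ-profile = cong (_∧ conn s i j) sepWI-profile

-- Contraction.  Edge sets of H/ij are images of edge sets of H avoiding the i–j edges, with j
-- renamed to i; connectivity in the image is connectivity in s + ij.

subsets-map : ∀ {A B : Set} (f : A → B) xs → subsets (map f xs) ≡ map (map f) (subsets xs)
subsets-map f [] = refl
subsets-map f (x ∷ xs) = begin
    subsets (map f xs) ++ map (f x ∷_) (subsets (map f xs))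
  ≡⟨ cong (λ z → z ++ map (f x ∷_) z) (subsets-map f xs) ⟩
    map (map f) S ++ map (f x ∷_) (map (map f) S)
  ≡⟨ cong (map (map f) S ++_) (trans (sym (map-∘ S)) (map-∘ S)) ⟩
    map (map f) S ++ map (map f) (map (x ∷_) S)
  ≡⟨ sym (map-++ (map f) S _) ⟩
    map (map f) (subsets (x ∷ xs))
  ∎
  where open ≡-Reasoning
        S = subsets xs

splits-map : ∀ {A B : Set} (f : A → B) xs →
  splits (map f xs) ≡ map (λ p → f (proj₁ p) , map f (proj₂ p)) (splits xs)
splits-map f [] = refl
splits-map f (x ∷ xs) = cong ((f x , map f xs) ∷_)
  (trans (cong (map (λ p → proj₁ p , f x ∷ proj₂ p)) (splits-map f xs))
         (trans (sym (map-∘ (splits xs))) (map-∘ (splits xs))))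

not-∨ : ∀ a b → not (a ∨ b) ≡ not a ∧ not b
not-∨ true  _ = refl
not-∨ false _ = refl

module Contraction {n : ℕ} (i j : Fin n) (i≢j : i ≢ j) where

  merge : Fin n → Fin n
  merge = mergeV i j

  mergeE : Fin n × Fin n → Fin n × Fin n
  mergeE e = merge (proj₁ e) , merge (proj₂ e)

  merge-i : merge i ≡ i
  merge-i with i == j
  ... | true  = refl
  ... | false = refl

  merge-j : merge j ≡ i
  merge-j with j == j in eq
  ... | true  = refl
  ... | false = ⊥-elim (subst T eq (≡→== refl))

  merge-other : ∀ x → x ≢ j → merge x ≡ x
  merge-other x x≢j with x == j in eq
  ... | true  = ⊥-elim (x≢j (==→≡ (subst T (sym eq) _)))
  ... | false = refl

  count-dropIJ : ∀ (q : Edges n → Bool) →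
    (∀ s e → e ∈ s → T (isIJ i j e) → q s ≡ false) → ∀ E →
    countB q (subsets E) ≡ countB q (subsets (dropIJ i j E))
  count-dropIJ q hq [] = refl
  count-dropIJ q hq (e ∷ E) with isIJ i j e in eq
  ... | true = begin
      countB q (subsets (e ∷ E))
    ≡⟨ count-subsets-∷ q e E ⟩
      countB q (subsets E) ℕ.+ countB (q ∘ (e ∷_)) (subsets E)
    ≡⟨ cong (countB q (subsets E) ℕ.+_)
         (countB-false _ (subsets E) (λ s → hq (e ∷ s) e (here refl) (subst T (sym eq) _))) ⟩
      countB q (subsets E) ℕ.+ 0
    ≡⟨ ℕₚ.+-identityʳ _ ⟩
      countB q (subsets E)
    ≡⟨ count-dropIJ q hq E ⟩
      countB q (subsets (dropIJ i j E))
    ∎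
    where open ≡-Reasoning
  ... | false = begin
      countB q (subsets (e ∷ E))
    ≡⟨ count-subsets-∷ q e E ⟩
      countB q (subsets E) ℕ.+ countB (q ∘ (e ∷_)) (subsets E)
    ≡⟨ cong₂ ℕ._+_ (count-dropIJ q hq E)
         (count-dropIJ (q ∘ (e ∷_)) (λ s f f∈s → hq (e ∷ s) f (there f∈s)) E) ⟩
      countB q (subsets (dropIJ i j E)) ℕ.+ countB (q ∘ (e ∷_)) (subsets (dropIJ i j E))
    ≡⟨ sym (count-subsets-∷ q e (dropIJ i j E)) ⟩
      countB q (subsets (e ∷ dropIJ i j E))
    ∎
    where open ≡-Reasoning

  isIJ-conn : ∀ s e → e ∈ s → T (isIJ i j e) → Conn s i j
  isIJ-conn s (a , b) e∈s t with T∨ {(a == i) ∧ (b == j)} t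
  ... | inj₁ ab with ==→≡ {x = a} (T∧₁ ab) | ==→≡ {x = b} (T∧₂ {a == i} ab)
  ...   | refl | refl = conn-edge s a b e∈s
  isIJ-conn s (a , b) e∈s t | inj₂ ba with ==→≡ {x = a} (T∧₁ ba) | ==→≡ {x = b} (T∧₂ {a == j} ba)
  ...   | refl | refl = conn-sym s j i (conn-edge s a b e∈s)

  module _ (s : Edges n) where

    s/ij = map mergeE s
    s+ij = (i , j) ∷ s

    near : ∀ z → Conn s+ij z (merge z)
    near z with z == j in eq
    ... | true  = subst (λ y → Conn s+ij y i) (sym (==→≡ (subst T (sym eq) _)))
                    (conn-sym s+ij i j (conn-edge s+ij i j (here refl)))
    ... | false = conn-refl s+ij z

    conn-merge⁺ : ∀ x y → Conn s+ij x y → Conn s/ij (merge x) (merge y)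
    conn-merge⁺ x y = conn-ind s+ij x (λ z → Conn s/ij (merge x) (merge z)) (conn-refl s/ij (merge x)) closed y
      where
      closed : ∀ a b → (a , b) ∈ s+ij →
        (Conn s/ij (merge x) (merge a) → Conn s/ij (merge x) (merge b)) ×
        (Conn s/ij (merge x) (merge b) → Conn s/ij (merge x) (merge a))
      closed a b (here refl) = subst (Conn s/ij (merge x)) (trans merge-i (sym merge-j)) ,
                               subst (Conn s/ij (merge x)) (trans merge-j (sym merge-i))
      closed a b (there m)   = conn-edgeF s/ij (merge x) (merge a) (merge b) (∈-map⁺ mergeE m) ,
                               conn-edgeB s/ij (merge x) (merge a) (merge b) (∈-map⁺ mergeE m)

    conn-merge⁻ : ∀ x y → Conn s/ij (merge x) (merge y) → Conn s+ij x y
    conn-merge⁻ x y c = conn-trans s+ij x (merge y) y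
      (conn-ind s/ij (merge x) (Conn s+ij x) (near x) closed (merge y) c)
      (conn-sym s+ij y (merge y) (near y))
      where
      through : ∀ {a b} → Conn s+ij a b → Conn s+ij x (merge a) → Conn s+ij x (merge b)
      through {a} {b} ab p = conn-trans s+ij x b (merge b)
        (conn-trans s+ij x a b (conn-trans s+ij x (merge a) a p (conn-sym s+ij a (merge a) (near a))) ab)
        (near b)
      closed : ∀ c d → (c , d) ∈ s/ij → (Conn s+ij x c → Conn s+ij x d) × (Conn s+ij x d → Conn s+ij x c)
      closed c d m with ∈-map⁻ mergeE m
      ... | (a , b) , ab∈s , refl = through ab , through (conn-sym s+ij a b ab)
        where ab = conn-edge s+ij a b (there ab∈s)

  acyclic-merge : ∀ s → acyclic (s/ij s) ≡ (acyclic s ∧ not (conn s i j))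
  acyclic-merge s = T-ext
    (λ t → let (ac , no-ij) = ⇒ (acyclic→Acyclic (s/ij s) t) in T∧ (Acyclic→acyclic s ac) (Tnot no-ij))
    (λ t → Acyclic→acyclic (s/ij s) (⇐ (acyclic→Acyclic s (T∧₁ t)) (Tnot⁻ (T∧₂ {acyclic s} t))))
    where
    splits-merge : ∀ {e r} → (e , r) ∈ splits s → (mergeE e , s/ij r) ∈ splits (s/ij s)
    splits-merge m = subst (_ ∈_) (sym (splits-map mergeE s)) (∈-map⁺ _ m)
    ⇒ : Acyclic (s/ij s) → Acyclic s × ¬ Conn s i j
    ⇒ h = ac , not-both-join i j i≢j [ (i , j) ] s no-cycle (conn-edge _ i j (here refl))
      where
      no-cycle : ∀ e r → (e , r) ∈ splits s → ¬ Conn (r ++ [ (i , j) ]) (proj₁ e) (proj₂ e)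
      no-cycle (a , b) r m c = h (mergeE (a , b)) (s/ij r) (splits-merge m)
        (conn-merge⁺ r a b (conn-comm r [ (i , j) ] a b c))
      ac : Acyclic s
      ac e r m = no-cycle e r m ∘ conn-mono (xs⊆xs++ys r _) _ _
    ⇐ : Acyclic s → ¬ Conn s i j → Acyclic (s/ij s)
    ⇐ h no-ij e' r' m c with ∈-map⁻ _ (subst (_ ∈_) (splits-map mergeE s) m)
    ... | ((a , b) , r) , mr , refl with conn-remove r i j a b (conn-merge⁻ r a b c)
    ...   | inj₁ q = h (a , b) r mr q
    ...   | inj₂ (inj₁ (p , q)) = no-ij (conn-trans s i a j (conn-sym s a i (inS a i p))
                                  (conn-trans s a b j ab (conn-sym s j b (inS j b q))))
      where inS = conn-mono (splits-rest s mr)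
            ab = conn-edge s a b (splits-elem s mr)
    ...   | inj₂ (inj₂ (p , q)) = no-ij (conn-trans s i b j (inS i b q)
                                  (conn-trans s b a j (conn-sym s a b ab) (inS a j p)))
      where inS = conn-mono (splits-rest s mr)
            ab = conn-edge s a b (splits-elem s mr)

  module ContractedSide (H : RawGraph n) (w : Fin n) (vw : T (V H w)) (vi : T (V H i)) (vj : T (V H j)) where

    open SideProfile H w i j vw vi vj using (profile; Cov)

    H/ij = contract H i j

    conn-merged-i : ∀ s → conn (s/ij s) (merge w) i ≡ (conn s w i ∨ conn s w j)
    conn-merged-i s = T-ext
      (λ t → out (conn-remove s i j w i (conn-merge⁻ s w i (subst (Conn (s/ij s) (merge w)) (sym merge-i) t))))
      (λ t → subst (Conn (s/ij s) (merge w)) merge-i (conn-merge⁺ s w i (into (T∨ t))))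
      where
      out : ConnVia s i j w i → T (conn s w i ∨ conn s w j)
      out (inj₁ p)              = T∨₁ p
      out (inj₂ (inj₁ (p , _))) = T∨₁ p
      out (inj₂ (inj₂ (p , _))) = T∨₂ {conn s w i} p
      into : Conn s w i ⊎ Conn s w j → Conn (s+ij s) w i
      into (inj₁ p) = conn-mono (xs⊆x∷xs s _) w i p
      into (inj₂ p) = conn-trans (s+ij s) w j i (conn-mono (xs⊆x∷xs s _) w j p)
                        (conn-sym (s+ij s) i j (conn-edge (s+ij s) i j (here refl)))

    covered-merged : ∀ s → forallV H/ij (λ x → conn (s/ij s) (merge w) x ∨ conn (s/ij s) i x) ≡ Cov s
    covered-merged s = T-ext
      (λ t → →covered H s w i j (λ x vx → cover t x vx))
      (λ t → →forallV H/ij _ λ x vx' → let vx = T∧₁ vx' ; x≢j = λ e → Tnot⁻ (T∧₂ {V H x} vx') (≡→== e) in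
               uncover x x≢j (covered→ H s w i j t x vx))
      where
      S/ = s/ij s
      S+ = s+ij s
      Cover3 = λ x → Conn s w x ⊎ Conn s i x ⊎ Conn s j x
      from-w : ∀ x → ConnVia s i j w x → Cover3 x
      from-w x (inj₁ p)              = inj₁ p
      from-w x (inj₂ (inj₁ (_ , p))) = inj₂ (inj₂ p)
      from-w x (inj₂ (inj₂ (_ , p))) = inj₂ (inj₁ p)
      from-i : ∀ x → ConnVia s i j i x → Cover3 x
      from-i x (inj₁ p)              = inj₂ (inj₁ p)
      from-i x (inj₂ (inj₁ (_ , p))) = inj₂ (inj₂ p)
      from-i x (inj₂ (inj₂ (_ , p))) = inj₂ (inj₁ p)
      cover : T (forallV H/ij (λ x → conn S/ (merge w) x ∨ conn S/ i x)) → ∀ x → T (V H x) → Cover3 x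
      cover t x vx with T-dec (x == j)
      ... | inj₁ x=j = inj₂ (inj₂ (subst (Conn s j) (sym (==→≡ x=j)) (conn-refl s j)))
      ... | inj₂ x≠j with T∨ (forallV→ H/ij _ t x (T∧ vx (Tnot x≠j)))
      ...   | inj₁ p = from-w x (conn-remove s i j w x (conn-merge⁻ s w x
                         (subst (Conn S/ (merge w)) (sym (merge-other x (x≠j ∘ ≡→==))) p)))
      ...   | inj₂ p = from-i x (conn-remove s i j i x (conn-merge⁻ s i x
                         (subst₂ (Conn S/) (sym merge-i) (sym (merge-other x (x≠j ∘ ≡→==))) p)))
      uncover : ∀ x → x ≢ j → Cover3 x → T (conn S/ (merge w) x ∨ conn S/ i x)
      uncover x x≢j (inj₁ p) = T∨₁ (subst (Conn S/ (merge w)) (merge-other x x≢j)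
        (conn-merge⁺ s w x (conn-mono (xs⊆x∷xs s _) w x p)))
      uncover x x≢j (inj₂ (inj₁ p)) = T∨₂ {conn S/ (merge w) x} (subst₂ (Conn S/) merge-i (merge-other x x≢j)
        (conn-merge⁺ s i x (conn-mono (xs⊆x∷xs s _) i x p)))
      uncover x x≢j (inj₂ (inj₂ p)) = T∨₂ {conn S/ (merge w) x} (subst₂ (Conn S/) merge-i (merge-other x x≢j)
        (conn-merge⁺ s i x (conn-trans S+ i j x (conn-edge S+ i j (here refl)) (conn-mono (xs⊆x∷xs s _) j x p))))

    apart-profile : ∀ s → isF2 H/ij (merge w) i (s/ij s) ≡ apart (profile s)
    apart-profile s = begin
        acyclic (s/ij s) ∧ not (conn (s/ij s) (merge w) i) ∧ cov/ij
      ≡⟨ cong₂ (λ p q → p ∧ not q ∧ cov/ij) (acyclic-merge s) (conn-merged-i s) ⟩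
        (acyclic s ∧ not c) ∧ not (a ∨ b) ∧ cov/ij
      ≡⟨ cong₂ (λ p q → (acyclic s ∧ not c) ∧ p ∧ q) (not-∨ a b) (covered-merged s) ⟩
        (acyclic s ∧ not c) ∧ (not a ∧ not b) ∧ Cov s
      ≡⟨ solve 5 (λ f nc na nb cv → (f ⊕ nc) ⊕ (na ⊕ nb) ⊕ cv ⊜ (f ⊕ cv) ⊕ na ⊕ nb ⊕ nc) refl
           (acyclic s) (not c) (not a) (not b) (Cov s) ⟩
        apart (profile s)
      ∎
      where
      open ≡-Reasoning
      a = conn s w i
      b = conn s w j
      c = conn s i j
      cov/ij = forallV H/ij (λ x → conn (s/ij s) (merge w) x ∨ conn (s/ij s) i x)

    apart-joined : ∀ s → Conn s i j → apart (profile s) ≡ false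
    apart-joined s c = subst (λ z → apart (acyclic s ∧ Cov s , conn s w i , conn s w j , z) ≡ false)
      (sym (Equivalence.to T-≡ c)) (apart-ij (acyclic s ∧ Cov s) (conn s w i) (conn s w j))
      where
      apart-ij : ∀ g a b → apart (g , a , b , true) ≡ false
      apart-ij false _     _     = refl
      apart-ij true  true  _     = refl
      apart-ij true  false true  = refl
      apart-ij true  false false = refl

    contraction-count : 𝓕 H/ij (merge w) i ≡ countB (apart ∘ profile) (subsets (E H))
    contraction-count = begin
        countB (isF2 H/ij (merge w) i) (subsets (map mergeE (dropIJ i j (E H))))
      ≡⟨ cong (countB _) (subsets-map mergeE (dropIJ i j (E H))) ⟩
        countB (isF2 H/ij (merge w) i) (map s/ij (subsets (dropIJ i j (E H))))
      ≡⟨ countB-map _ s/ij (subsets (dropIJ i j (E H))) ⟩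
        countB (isF2 H/ij (merge w) i ∘ s/ij) (subsets (dropIJ i j (E H)))
      ≡⟨ countB-cong _ _ (subsets (dropIJ i j (E H))) (λ {s} _ → apart-profile s) ⟩
        countB (apart ∘ profile) (subsets (dropIJ i j (E H)))
      ≡⟨ sym (count-dropIJ (apart ∘ profile) (λ s e e∈s ij → apart-joined s (isIJ-conn s e e∈s ij)) (E H)) ⟩
        countB (apart ∘ profile) (subsets (E H))
      ∎
      where open ≡-Reasoning

side-cover : ∀ {n} (W₁ W₂ : Fin n → Bool) (T₁ T₂ : Edges n) (ins₁ : Inside W₁ T₁) (ins₂ : Inside W₂ T₂)
  (i j : Fin n) (sep : ∀ x → T (W₁ x) → T (W₂ x) → x ≡ i ⊎ x ≡ j) (x y : Fin n) → T (W₁ x) → T (W₂ y) →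
  ∀ z → T (W₁ z) → Conn (T₁ ++ T₂) x z ⊎ Conn (T₁ ++ T₂) y z → Conn T₁ x z ⊎ Conn T₁ i z ⊎ Conn T₁ j z
side-cover W₁ W₂ T₁ T₂ ins₁ ins₂ i j sep x y wx wy z wz (inj₁ c)
  with proj₁ (Glue.glue W₁ W₂ T₁ T₂ ins₁ ins₂ i j sep x wx z c) wz
... | inj₁ p                = inj₁ p
... | inj₂ (_ , inj₁ (_ , p)) = inj₂ (inj₂ p)
... | inj₂ (_ , inj₂ (_ , p)) = inj₂ (inj₁ p)
side-cover W₁ W₂ T₁ T₂ ins₁ ins₂ i j sep x y wx wy z wz (inj₂ c)
  with proj₂ (Glue.glue W₂ W₁ T₂ T₁ ins₂ ins₁ i j (λ x w₂ w₁ → sep x w₁ w₂) y wy z (conn-comm T₁ T₂ y z c)) wz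
... | inj₁ (_ , p) = inj₂ (inj₁ p)
... | inj₂ (_ , p) = inj₂ (inj₂ p)

conn-++-comm : ∀ {n} (A B : Edges n) x y → conn (A ++ B) x y ≡ conn (B ++ A) x y
conn-++-comm A B x y = T-ext (conn-comm A B x y) (conn-comm B A x y)

-- The gluing rule: from the profiles of s₁ (terminal u) and s₂ (terminal v), whether s₁ ++ s₂
-- is a 2-forest separating u and v.  ui says u ∼ i in the union, and similarly for uj, vi, vj.
glued : Profile → Profile → Bool
glued (g₁ , a₁ , b₁ , c₁) (g₂ , a₂ , b₂ , c₂) =
  let ui = a₁ ∨ (b₁ ∧ c₂) ; uj = b₁ ∨ (a₁ ∧ c₂) ; vi = a₂ ∨ (b₂ ∧ c₁) ; vj = b₂ ∨ (a₂ ∧ c₁) in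
  g₁ ∧ g₂ ∧ not (c₁ ∧ c₂) ∧ not ((ui ∧ vi) ∨ (uj ∧ vj)) ∧ (ui ∨ vi) ∧ (uj ∨ vj)

module Gluing {n : ℕ} (G G₁ G₂ : RawGraph n) (hV : ∀ x → V G x ≡ (V G₁ x ∨ V G₂ x))
  (i j : Fin n) (i≢j : i ≢ j) (sep : ∀ x → T (V G₁ x) → T (V G₂ x) → x ≡ i ⊎ x ≡ j)
  (u v : Fin n) (vu : T (V G₁ u)) (vv : T (V G₂ v))
  (vi₁ : T (V G₁ i)) (vj₁ : T (V G₁ j)) (vi₂ : T (V G₂ i)) (vj₂ : T (V G₂ j))
  (s₁ s₂ : Edges n) (ins₁ : Inside (V G₁) s₁) (ins₂ : Inside (V G₂) s₂) where

  S = s₁ ++ s₂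
  C = Conn S

  sep-ji : ∀ x → T (V G₁ x) → T (V G₂ x) → x ≡ j ⊎ x ≡ i
  sep-ji x w₁ w₂ = either inj₂ inj₁ (sep x w₁ w₂)

  sep₂₁ : ∀ x → T (V G₂ x) → T (V G₁ x) → x ≡ i ⊎ x ≡ j
  sep₂₁ x w₂ w₁ = sep x w₁ w₂

  module P₁ = SideProfile G₁ u i j vu vi₁ vj₁ s₁
  module P₂ = SideProfile G₂ v i j vv vi₂ vj₂ s₂
  module Glue₁ = Glue (V G₁) (V G₂) s₁ s₂ ins₁ ins₂ i j sep

  conn-ui : conn S u i ≡ (conn s₁ u i ∨ (conn s₁ u j ∧ conn s₂ i j))
  conn-ui = Glue₁.conn-across u vu vi₁

  conn-uj : conn S u j ≡ (conn s₁ u j ∨ (conn s₁ u i ∧ conn s₂ i j))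
  conn-uj = trans (Glue.conn-across (V G₁) (V G₂) s₁ s₂ ins₁ ins₂ j i sep-ji u vu vj₁)
                  (cong (λ c → conn s₁ u j ∨ (conn s₁ u i ∧ c)) (conn-symm s₂ j i))

  conn-vi : conn S v i ≡ (conn s₂ v i ∨ (conn s₂ v j ∧ conn s₁ i j))
  conn-vi = trans (conn-++-comm s₁ s₂ v i)
                  (Glue.conn-across (V G₂) (V G₁) s₂ s₁ ins₂ ins₁ i j sep₂₁ v vv vi₂)

  conn-vj : conn S v j ≡ (conn s₂ v j ∨ (conn s₂ v i ∧ conn s₁ i j))
  conn-vj = trans (conn-++-comm s₁ s₂ v j)
    (trans (Glue.conn-across (V G₂) (V G₁) s₂ s₁ ins₂ ins₁ j i (λ x w₂ w₁ → sep-ji x w₁ w₂) v vv vj₂)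
           (cong (λ c → conn s₂ v j ∨ (conn s₂ v i ∧ c)) (conn-symm s₁ j i)))

  -- a walk from u to v crosses the separator
  conn-uv : conn S u v ≡ ((conn S u i ∧ conn S v i) ∨ (conn S u j ∧ conn S v j))
  conn-uv = T-ext (λ t → out (proj₂ (Glue₁.glue u vu v t) vv)) (λ t → into (T∨ t))
    where
    out : Glue₁.Reach₂ u v → T ((conn S u i ∧ conn S v i) ∨ (conn S u j ∧ conn S v j))
    out (inj₁ (r , p)) = T∨₁ (T∧ (Glue₁.Reach₁→C u i r) (conn-sym S i v (Glue₁.C₂→C i v p)))
    out (inj₂ (r , p)) = T∨₂ {conn S u i ∧ conn S v i}
                            (T∧ (Glue₁.Reach₁→C u j r) (conn-sym S j v (Glue₁.C₂→C j v p)))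
    into : T (conn S u i ∧ conn S v i) ⊎ T (conn S u j ∧ conn S v j) → C u v
    into (inj₁ p) = conn-trans S u i v (T∧₁ p) (conn-sym S v i (T∧₂ {conn S u i} p))
    into (inj₂ p) = conn-trans S u j v (T∧₁ p) (conn-sym S v j (T∧₂ {conn S u j} p))

  covered-uv : forallV G (λ x → conn S u x ∨ conn S v x) ≡
    (P₁.Cov ∧ P₂.Cov ∧ (conn S u i ∨ conn S v i) ∧ (conn S u j ∨ conn S v j))
  covered-uv = T-ext
    (λ t → let at = λ x vx → T∨ {conn S u x} (forallV→ G _ t x vx) in
      T∧ (→covered G₁ s₁ u i j (λ x vx → side-cover (V G₁) (V G₂) s₁ s₂ ins₁ ins₂ i j sep u v vu vv x vx
                                             (at x (inG₁ x vx))))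
        (T∧ (→covered G₂ s₂ v i j (λ x vx → side-cover (V G₂) (V G₁) s₂ s₁ ins₂ ins₁ i j sep₂₁ v u vv vu x vx
                                             (swap⊎ (conn-comm s₁ s₂ u x) (conn-comm s₁ s₂ v x) (at x (inG₂ x vx)))))
          (T∧ (forallV→ G _ t i (inG₁ i vi₁)) (forallV→ G _ t j (inG₁ j vj₁)))))
    (λ t → let c₁ = T∧₁ t ; t' = T∧₂ {P₁.Cov} t ; c₂ = T∧₁ t' ; t'' = T∧₂ {P₂.Cov} t'
               ti = T∨ (T∧₁ t'') ; tj = T∨ (T∧₂ {conn S u i ∨ conn S v i} t'') in
      →forallV G _ λ x vx → toOr (join ti tj x (sides c₁ c₂ x (T∨ (subst T (hV x) vx)))))
    where
    inG₁ : ∀ x → T (V G₁ x) → T (V G x)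
    inG₁ x t = subst T (sym (hV x)) (T∨₁ t)
    inG₂ : ∀ x → T (V G₂ x) → T (V G x)
    inG₂ x t = subst T (sym (hV x)) (T∨₂ {V G₁ x} t)
    swap⊎ : ∀ {A A' B B' : Set} → (A → A') → (B → B') → A ⊎ B → B' ⊎ A'
    swap⊎ f g = either (inj₂ ∘ f) (inj₁ ∘ g)
    toOr : ∀ {x} → C u x ⊎ C v x → T (conn S u x ∨ conn S v x)
    toOr {x} = either T∨₁ (T∨₂ {conn S u x})
    sides : T P₁.Cov → T P₂.Cov → ∀ x → T (V G₁ x) ⊎ T (V G₂ x) →
      (Conn s₁ u x ⊎ Conn s₁ i x ⊎ Conn s₁ j x) ⊎ (Conn s₂ v x ⊎ Conn s₂ i x ⊎ Conn s₂ j x)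
    sides c₁ c₂ x (inj₁ w) = inj₁ (covered→ G₁ s₁ u i j c₁ x w)
    sides c₁ c₂ x (inj₂ w) = inj₂ (covered→ G₂ s₂ v i j c₂ x w)
    via : ∀ {x} k → C u k ⊎ C v k → C k x → C u x ⊎ C v x
    via {x} k (inj₁ q) p = inj₁ (conn-trans S u k x q p)
    via {x} k (inj₂ q) p = inj₂ (conn-trans S v k x q p)
    join : C u i ⊎ C v i → C u j ⊎ C v j → ∀ x →
      (Conn s₁ u x ⊎ Conn s₁ i x ⊎ Conn s₁ j x) ⊎ (Conn s₂ v x ⊎ Conn s₂ i x ⊎ Conn s₂ j x) → C u x ⊎ C v x
    join ti tj x (inj₁ (inj₁ p))        = inj₁ (Glue₁.C₁→C u x p)
    join ti tj x (inj₁ (inj₂ (inj₁ p))) = via i ti (Glue₁.C₁→C i x p)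
    join ti tj x (inj₁ (inj₂ (inj₂ p))) = via j tj (Glue₁.C₁→C j x p)
    join ti tj x (inj₂ (inj₁ p))        = inj₂ (Glue₁.C₂→C v x p)
    join ti tj x (inj₂ (inj₂ (inj₁ p))) = via i ti (Glue₁.C₂→C i x p)
    join ti tj x (inj₂ (inj₂ (inj₂ p))) = via j tj (Glue₁.C₂→C j x p)

  glued-profiles : isF2 G u v S ≡ glued P₁.profile P₂.profile
  glued-profiles = begin
      acyclic S ∧ not (conn S u v) ∧ forallV G (λ x → conn S u x ∨ conn S v x)
    ≡⟨ cong₂ (λ p q → p ∧ not q ∧ forallV G (λ x → conn S u x ∨ conn S v x))
         (acyclic-union (V G₁) (V G₂) s₁ s₂ ins₁ ins₂ i j i≢j sep) conn-uv ⟩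
      (acyclic s₁ ∧ acyclic s₂ ∧ X) ∧ not ((ui ∧ vi) ∨ (uj ∧ vj)) ∧ forallV G (λ x → conn S u x ∨ conn S v x)
    ≡⟨ cong (λ r → (acyclic s₁ ∧ acyclic s₂ ∧ X) ∧ not ((ui ∧ vi) ∨ (uj ∧ vj)) ∧ r) covered-uv ⟩
      (acyclic s₁ ∧ acyclic s₂ ∧ X) ∧ not ((ui ∧ vi) ∨ (uj ∧ vj)) ∧ (P₁.Cov ∧ P₂.Cov ∧ (ui ∨ vi) ∧ (uj ∨ vj))
    ≡⟨ solve 8 (λ a₁ a₂ c₁ c₂ x y zi zj → (a₁ ⊕ a₂ ⊕ x) ⊕ y ⊕ (c₁ ⊕ c₂ ⊕ zi ⊕ zj)
                                        ⊜ (a₁ ⊕ c₁) ⊕ (a₂ ⊕ c₂) ⊕ x ⊕ y ⊕ zi ⊕ zj) refl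
         (acyclic s₁) (acyclic s₂) P₁.Cov P₂.Cov X (not ((ui ∧ vi) ∨ (uj ∧ vj))) (ui ∨ vi) (uj ∨ vj) ⟩
      (acyclic s₁ ∧ P₁.Cov) ∧ (acyclic s₂ ∧ P₂.Cov) ∧ X ∧ not ((ui ∧ vi) ∨ (uj ∧ vj)) ∧ (ui ∨ vi) ∧ (uj ∨ vj)
    ≡⟨ cong₂ (λ p q → (acyclic s₁ ∧ P₁.Cov) ∧ (acyclic s₂ ∧ P₂.Cov) ∧ X ∧ p ∧ q)
         (cong not (cong₂ _∨_ (cong₂ _∧_ conn-ui conn-vi) (cong₂ _∧_ conn-uj conn-vj)))
         (cong₂ _∧_ (cong₂ _∨_ conn-ui conn-vi) (cong₂ _∨_ conn-uj conn-vj)) ⟩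
      glued P₁.profile P₂.profile
    ∎
    where
    open ≡-Reasoning
    X = not (conn s₁ i j ∧ conn s₂ i j)
    ui = conn S u i
    uj = conn S u j
    vi = conn S v i
    vj = conn S v j

-- The pointwise identity.  Transitive patterns are exactly those of the five partitions of
-- {w, i, j}; on these the gluing rule is checked against the summand of the theorem.

data Partition : Set where
  wij wi∣j wj∣i ij∣w w∣i∣j : Partition

patternOf : Partition → Pattern
patternOf wij   = true  , true  , true
patternOf wi∣j  = true  , false , false
patternOf wj∣i  = false , true  , false
patternOf ij∣w  = false , false , true
patternOf w∣i∣j = false , false , false

classify : ∀ p → Coherent p → Σ Partition (λ π → patternOf π ≡ p)
classify (true  , true  , true)  _ = wij , refl
classify (true  , true  , false) k = ⊥-elim (proj₁ k _ _)
classify (true  , false , true)  k = ⊥-elim (proj₁ (proj₂ k) _ _)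
classify (true  , false , false) _ = wi∣j , refl
classify (false , true  , true)  k = ⊥-elim (proj₂ (proj₂ k) _ _)
classify (false , true  , false) _ = wj∣i , refl
classify (false , false , true)  _ = ij∣w , refl
classify (false , false , false) _ = w∣i∣j , refl

weight : Profile → Profile → ℤ
weight l₁ l₂ = ⟦ apart l₁ ⟧ * ⟦ isTree l₂ ⟧ + ⟦ isTree l₁ ⟧ * ⟦ apart l₂ ⟧
             + ⟦ sepWI l₁ ⟧ * ⟦ sepWJ l₂ ⟧ + ⟦ sepWJ l₁ ⟧ * ⟦ sepWI l₂ ⟧
             - + 2 * (⟦ sepW-IJ l₁ ⟧ * ⟦ sepW-IJ l₂ ⟧)

glued-weight : ∀ g₁ π₁ g₂ π₂ → let l₁ = (g₁ , patternOf π₁) ; l₂ = (g₂ , patternOf π₂) in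
  ⟦ glued l₁ l₂ ⟧ ≡ weight l₁ l₂
glued-weight false _     _     _     = refl
glued-weight true  wij   false _     = refl
glued-weight true  wi∣j  false _     = refl
glued-weight true  wj∣i  false _     = refl
glued-weight true  ij∣w  false _     = refl
glued-weight true  w∣i∣j false _     = refl
glued-weight true  wij   true  wij   = refl
glued-weight true  wij   true  wi∣j  = refl
glued-weight true  wij   true  wj∣i  = refl
glued-weight true  wij   true  ij∣w  = refl
glued-weight true  wij   true  w∣i∣j = refl
glued-weight true  wi∣j  true  wij   = refl
glued-weight true  wi∣j  true  wi∣j  = refl
glued-weight true  wi∣j  true  wj∣i  = refl
glued-weight true  wi∣j  true  ij∣w  = refl
glued-weight true  wi∣j  true  w∣i∣j = refl
glued-weight true  wj∣i  true  wij   = refl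
glued-weight true  wj∣i  true  wi∣j  = refl
glued-weight true  wj∣i  true  wj∣i  = refl
glued-weight true  wj∣i  true  ij∣w  = refl
glued-weight true  wj∣i  true  w∣i∣j = refl
glued-weight true  ij∣w  true  wij   = refl
glued-weight true  ij∣w  true  wi∣j  = refl
glued-weight true  ij∣w  true  wj∣i  = refl
glued-weight true  ij∣w  true  ij∣w  = refl
glued-weight true  ij∣w  true  w∣i∣j = refl
glued-weight true  w∣i∣j true  wij   = refl
glued-weight true  w∣i∣j true  wi∣j  = refl
glued-weight true  w∣i∣j true  wj∣i  = refl
glued-weight true  w∣i∣j true  ij∣w  = refl
glued-weight true  w∣i∣j true  w∣i∣j = refl

glued-weight-coherent : ∀ l₁ l₂ → Coherent (proj₂ l₁) → Coherent (proj₂ l₂) →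
  ⟦ glued l₁ l₂ ⟧ ≡ weight l₁ l₂
glued-weight-coherent (g₁ , p₁) (g₂ , p₂) k₁ k₂ with classify p₁ k₁ | classify p₂ k₂
... | π₁ , refl | π₂ , refl = glued-weight g₁ π₁ g₂ π₂

rhs : (c₁ t₂ c₂ t₁ i₁ j₂ j₁ i₂ x₁ x₂ : ℤ) → ℤ
rhs c₁ t₂ c₂ t₁ i₁ j₂ j₁ i₂ x₁ x₂ = c₁ * t₂ + c₂ * t₁ + i₁ * j₂ + j₁ * i₂ - + 2 * (x₁ * x₂)

rhs-cong : ∀ {c₁ t₂ c₂ t₁ i₁ j₂ j₁ i₂ x₁ x₂ c₁' t₂' c₂' t₁' i₁' j₂' j₁' i₂' x₁' x₂' : ℤ} →
  c₁ ≡ c₁' → t₂ ≡ t₂' → c₂ ≡ c₂' → t₁ ≡ t₁' → i₁ ≡ i₁' → j₂ ≡ j₂' → j₁ ≡ j₁' → i₂ ≡ i₂' →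
  x₁ ≡ x₁' → x₂ ≡ x₂' → rhs c₁ t₂ c₂ t₁ i₁ j₂ j₁ i₂ x₁ x₂ ≡ rhs c₁' t₂' c₂' t₁' i₁' j₂' j₁' i₂' x₁' x₂'
rhs-cong refl refl refl refl refl refl refl refl refl refl = refl

module DoubleSum {A B : Set} (X₁ : List A) (X₂ : List B) where

  ∑∑ : (A → B → ℤ) → ℤ
  ∑∑ f = ∑ X₁ (λ a → ∑ X₂ (f a))

  ∑∑-+ : ∀ f g → ∑∑ (λ a b → f a b + g a b) ≡ ∑∑ f + ∑∑ g
  ∑∑-+ f g = trans (∑-cong X₁ _ _ (λ {a} _ → ∑-+ X₂ (f a) (g a))) (∑-+ X₁ _ _)

  ∑∑-neg : ∀ f → ∑∑ (λ a b → - f a b) ≡ - ∑∑ f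
  ∑∑-neg f = trans (∑-cong X₁ _ _ (λ {a} _ → ∑-neg X₂ (f a))) (∑-neg X₁ _)

  ∑∑-*ˡ : ∀ c f → ∑∑ (λ a b → c * f a b) ≡ c * ∑∑ f
  ∑∑-*ˡ c f = trans (∑-cong X₁ _ _ (λ {a} _ → ∑-*ˡ X₂ c (f a))) (∑-*ˡ X₁ c _)

  ∑∑-product : ∀ (f : A → ℤ) (g : B → ℤ) → ∑∑ (λ a b → f a * g b) ≡ ∑ X₁ f * ∑ X₂ g
  ∑∑-product f g = sym (∑-product X₁ X₂ f g)

  ∑∑-rhs : ∀ (c₁ t₁ i₁ j₁ x₁ : A → ℤ) (t₂ c₂ j₂ i₂ x₂ : B → ℤ) →
    rhs (∑ X₁ c₁) (∑ X₂ t₂) (∑ X₂ c₂) (∑ X₁ t₁) (∑ X₁ i₁) (∑ X₂ j₂) (∑ X₁ j₁) (∑ X₂ i₂) (∑ X₁ x₁) (∑ X₂ x₂)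
    ≡ ∑∑ (λ a b → c₁ a * t₂ b + t₁ a * c₂ b + i₁ a * j₂ b + j₁ a * i₂ b - + 2 * (x₁ a * x₂ b))
  ∑∑-rhs c₁ t₁ i₁ j₁ x₁ t₂ c₂ j₂ i₂ x₂ = sym (begin
      ∑∑ (λ a b → c₁ a * t₂ b + t₁ a * c₂ b + i₁ a * j₂ b + j₁ a * i₂ b - + 2 * (x₁ a * x₂ b))
    ≡⟨ ∑∑-+ _ _ ⟩
      ∑∑ (λ a b → c₁ a * t₂ b + t₁ a * c₂ b + i₁ a * j₂ b + j₁ a * i₂ b)
        + ∑∑ (λ a b → - (+ 2 * (x₁ a * x₂ b)))
    ≡⟨ cong₂ _+_
         (trans (∑∑-+ _ _) (cong (_+ ∑∑ (λ a b → j₁ a * i₂ b))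
           (trans (∑∑-+ _ _) (cong (_+ ∑∑ (λ a b → i₁ a * j₂ b)) (∑∑-+ _ _)))))
         (trans (∑∑-neg _) (cong -_ (∑∑-*ˡ (+ 2) _))) ⟩
      ∑∑ (λ a b → c₁ a * t₂ b) + ∑∑ (λ a b → t₁ a * c₂ b) + ∑∑ (λ a b → i₁ a * j₂ b)
        + ∑∑ (λ a b → j₁ a * i₂ b) - + 2 * ∑∑ (λ a b → x₁ a * x₂ b)
    ≡⟨ cong₂ _-_ (cong₂ _+_ (cong₂ _+_ (cong₂ _+_ (∑∑-product c₁ t₂)
                                              (trans (∑∑-product t₁ c₂) (ℤₚ.*-comm (∑ X₁ t₁) (∑ X₂ c₂))))
                                  (∑∑-product i₁ j₂))
                      (∑∑-product j₁ i₂))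
                 (cong (λ z → + 2 * z) (∑∑-product x₁ x₂)) ⟩
      rhs (∑ X₁ c₁) (∑ X₂ t₂) (∑ X₂ c₂) (∑ X₁ t₁) (∑ X₁ i₁) (∑ X₂ j₂) (∑ X₁ j₁) (∑ X₂ i₂) (∑ X₁ x₁) (∑ X₂ x₂)
    ∎)
    where open ≡-Reasoning

module SideCounts {n : ℕ} (H : RawGraph n) (w i j : Fin n) (i≢j : i ≢ j)
  (vw : T (V H w)) (vi : T (V H i)) (vj : T (V H j)) where

  open SideProfile H w i j vw vi vj public

  X : List (Edges n)
  X = subsets (E H)

  ind : (Profile → Bool) → Edges n → ℤ
  ind q s = ⟦ q (profile s) ⟧

  count-as-sum : ∀ (p : Edges n → Bool) q → (∀ s → p s ≡ q (profile s)) → + countB p X ≡ ∑ X (ind q)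
  count-as-sum p q h = trans (cong +_ (countB-cong p _ X (λ {s} _ → h s))) (countB-∑ _ X)

  τ-sum : + τ H ≡ ∑ X (ind isTree)
  τ-sum = count-as-sum _ isTree tree-profile

  sepWI-sum : + 𝓕 H w i ≡ ∑ X (ind sepWI)
  sepWI-sum = count-as-sum _ sepWI sepWI-profile

  sepWJ-sum : + 𝓕 H w j ≡ ∑ X (ind sepWJ)
  sepWJ-sum = count-as-sum _ sepWJ sepWJ-profile

  sepW-IJ-sum : + 𝓕₂ H w i j ≡ ∑ X (ind sepW-IJ)
  sepW-IJ-sum = count-as-sum _ sepW-IJ sepW-IJ-profile

  contraction-sum : + 𝓕 (contract H i j) (mergeV i j w) i ≡ ∑ X (ind apart)
  contraction-sum = trans (cong +_ (Contraction.ContractedSide.contraction-count i j i≢j H w vw vi vj))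
                          (countB-∑ _ X)

isF2-↭ : ∀ {n} (G : RawGraph n) u v → Respects↭ (isF2 G u v)
isF2-↭ G u v {s} {s'} p = cong₂ _∧_ (acyclic-↭ p)
  (cong₂ (λ c d → not c ∧ d) (conn-↭ u v)
    (forallV-cong G _ _ (λ x → cong₂ _∨_ (conn-↭ u x) (conn-↭ v x))))
  where
  conn-↭ : ∀ x y → conn s x y ≡ conn s' x y
  conn-↭ x y = T-ext (conn-mono (⊆-reflexive-↭ p) x y) (conn-mono (⊆-reflexive-↭ (↭-sym p)) x y)

Inside-subset : ∀ {n} (H : RawGraph n) → IsGraph H → ∀ {s} → s ∈ subsets (E H) → Inside (V H) s
Inside-subset H isH m = Inside-⊆ (V H) (subsets-⊆ (E H) m) (λ a b e∈E → All.lookup (IsGraph.closed isH) e∈E)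

module TwoSeparation {n : ℕ} (G G₁ G₂ : RawGraph n) (isG₁ : IsGraph G₁) (isG₂ : IsGraph G₂)
  (hV : ∀ x → V G x ≡ (V G₁ x ∨ V G₂ x)) (hE : E G ↭ (E G₁ ++ E G₂))
  (i j : Fin n) (i≢j : i ≢ j) (sep : ∀ x → T (V G₁ x) → T (V G₂ x) → x ≡ i ⊎ x ≡ j)
  (u v : Fin n) (vu : T (V G₁ u)) (vv : T (V G₂ v))
  (vi₁ : T (V G₁ i)) (vj₁ : T (V G₁ j)) (vi₂ : T (V G₂ i)) (vj₂ : T (V G₂ j)) where

  module S₁ = SideCounts G₁ u i j i≢j vu vi₁ vj₁
  module S₂ = SideCounts G₂ v i j i≢j vv vi₂ vj₂
  open DoubleSum S₁.X S₂.X public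

  two-forests-double-sum : + 𝓕 G u v ≡ ∑∑ (λ s₁ s₂ → weight (S₁.profile s₁) (S₂.profile s₂))
  two-forests-double-sum = begin
      + countB (isF2 G u v) (subsets (E G))
    ≡⟨ cong +_ (count-subsets-↭ hE (isF2 G u v) (isF2-↭ G u v)) ⟩
      + countB (isF2 G u v) (subsets (E G₁ ++ E G₂))
    ≡⟨ count-subsets-++ (isF2 G u v) (E G₁) (E G₂) ⟩
      ∑∑ (λ s₁ s₂ → ⟦ isF2 G u v (s₁ ++ s₂) ⟧)
    ≡⟨ ∑-cong S₁.X _ _ (λ {s₁} m₁ → ∑-cong S₂.X _ _ (λ {s₂} m₂ →
         trans (cong ⟦_⟧ (Gluing.glued-profiles G G₁ G₂ hV i j i≢j sep u v vu vv vi₁ vj₁ vi₂ vj₂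
                            s₁ s₂ (Inside-subset G₁ isG₁ m₁) (Inside-subset G₂ isG₂ m₂)))
               (glued-weight-coherent (S₁.profile s₁) (S₂.profile s₂) (S₁.coherent s₁) (S₂.coherent s₂)))) ⟩
      ∑∑ (λ s₁ s₂ → weight (S₁.profile s₁) (S₂.profile s₂))
    ∎
    where open ≡-Reasoning

theorem14 : ∀ {n} (G G₁ G₂ : RawGraph n) → IsGraph G → IsGraph G₁ → IsGraph G₂
    → (∀ x → V G x ≡ (V G₁ x ∨ V G₂ x))
    → E G ↭ (E G₁ ++ E G₂)
    → (i j : Fin n) → i ≢ j
    → (∀ x → T (V G₁ x ∧ V G₂ x) ⇔ (x ≡ i ⊎ x ≡ j))
    → (u v : Fin n) → T (V G₁ u) → T (V G₂ v)
    → + 𝓕 G u v ≡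
        + 𝓕 (contract G₁ i j) (mergeV i j u) i * + τ G₂
      + + 𝓕 (contract G₂ i j) (mergeV i j v) i * + τ G₁
      + + 𝓕 G₁ u i * + 𝓕 G₂ v j
      + + 𝓕 G₁ u j * + 𝓕 G₂ v i
      - + 2 * (+ 𝓕₂ G₁ u i j * + 𝓕₂ G₂ v i j)
theorem14 G G₁ G₂ _ isG₁ isG₂ hV hE i j i≢j hsep u v vu vv = begin
    + 𝓕 G u v
  ≡⟨ two-forests-double-sum ⟩
    ∑∑ (λ s₁ s₂ → weight (S₁.profile s₁) (S₂.profile s₂))
  ≡⟨ sym (∑∑-rhs (S₁.ind apart) (S₁.ind isTree) (S₁.ind sepWI) (S₁.ind sepWJ) (S₁.ind sepW-IJ)
                  (S₂.ind isTree) (S₂.ind apart) (S₂.ind sepWJ) (S₂.ind sepWI) (S₂.ind sepW-IJ)) ⟩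
    rhs (∑ S₁.X (S₁.ind apart)) (∑ S₂.X (S₂.ind isTree)) (∑ S₂.X (S₂.ind apart)) (∑ S₁.X (S₁.ind isTree))
        (∑ S₁.X (S₁.ind sepWI)) (∑ S₂.X (S₂.ind sepWJ)) (∑ S₁.X (S₁.ind sepWJ)) (∑ S₂.X (S₂.ind sepWI))
        (∑ S₁.X (S₁.ind sepW-IJ)) (∑ S₂.X (S₂.ind sepW-IJ))
  ≡⟨ sym (rhs-cong S₁.contraction-sum S₂.τ-sum S₂.contraction-sum S₁.τ-sum S₁.sepWI-sum S₂.sepWJ-sum
                   S₁.sepWJ-sum S₂.sepWI-sum S₁.sepW-IJ-sum S₂.sepW-IJ-sum) ⟩
    rhs (+ 𝓕 (contract G₁ i j) (mergeV i j u) i) (+ τ G₂) (+ 𝓕 (contract G₂ i j) (mergeV i j v) i) (+ τ G₁)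
        (+ 𝓕 G₁ u i) (+ 𝓕 G₂ v j) (+ 𝓕 G₁ u j) (+ 𝓕 G₂ v i) (+ 𝓕₂ G₁ u i j) (+ 𝓕₂ G₂ v i j)
  ∎
  where
  open ≡-Reasoning
  on-both : ∀ {x} → x ≡ i ⊎ x ≡ j → T (V G₁ x ∧ V G₂ x)
  on-both {x} = Equivalence.from (hsep x)
  open TwoSeparation G G₁ G₂ isG₁ isG₂ hV hE i j i≢j (λ x w₁ w₂ → Equivalence.to (hsep x) (T∧ w₁ w₂))
    u v vu vv (T∧₁ (on-both (inj₁ refl))) (T∧₁ (on-both (inj₂ refl)))
    (T∧₂ {V G₁ i} (on-both (inj₁ refl))) (T∧₂ {V G₁ j} (on-both (inj₂ refl)))
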